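{- Let $t$ be a positive integer. Let $G$ be an $n$-vertex bipartite graph with bipartition $(A,B)$ and $E\geq 4\sqrt{2t}\,n^{3/2}$ edges. Then the number of copies of $H_{1,t}$ in $G$ is at least $\frac{1}{2^{5t+2}t!}\frac{E^{3t+1}}{|A|^{2t}|B|^{2t}}$.
   Context: For positive integers $s,t$, $H_{s,t}$ is the graph obtained from an $s$-matching $x_1y_1,\dots,x_sy_s$ and a vertex-disjoint $t$-matching $x'_1y'_1,\dots,x'_ty'_t$ by adding the edges $x_ix'_j$ and $y_iy'_j$ for all $i\in[s]$, $j\in[t]$. A copy is a subgraph isomorphic to it. -}

module Defs where

open import Data.Nat using (ℕ; zero; suc; _+_; _*_; _^_; _≤_; _<ᵇ_)

open import Data.Bool using (Bool; true; false; not; _∧_; _xor_; if_then_else_)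
open import Data.Fin using (Fin; toℕ; _≟_)
open import Data.Fin.Subset using (Subset; _∈_; _∉_; ∁; ∣_∣)
open import Data.Maybe using (Maybe; just; nothing)
open import Data.Product using (Σ; _×_; _,_; proj₁)
open import Data.Sum using (_⊎_)
open import Data.List using (List; length; map; allFin)
open import Data.Nat.ListAction using (sum)
open import Data.List.Relation.Unary.All using (All)
open import Data.List.Relation.Unary.Unique.Propositional using (Unique)
open import Data.Vec using (Vec; lookup)
open import Function.Bundles using (_↔_; Inverse)
open import Relation.Nullary.Decidable using (⌊_⌋)
open import Relation.Binary.PropositionalEquality using (_≡_)

record SimpleGraph (n : ℕ) : Set where
  field
    adj     : Fin n → Fin n → Bool
    symm    : ∀ i j → adj i j ≡ adj j i
    irrefl  : ∀ i → adj i i ≡ false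

open SimpleGraph public

numEdges : ∀ {n} → SimpleGraph n → ℕ
numEdges {n} G =
  sum (map (λ i → sum (map (λ j → if (toℕ i <ᵇ toℕ j) ∧ adj G i j then 1 else 0)
                             (allFin n)))
           (allFin n))

IsBipartition : ∀ {n} → SimpleGraph n → Subset n → Set
IsBipartition G A =
  ∀ i j → adj G i j ≡ true → (i ∈ A × j ∉ A) ⊎ (i ∉ A × j ∈ A)

-- Vertices of H_{1,t}:  (false , nothing) = x₁, (true , nothing) = y₁,
-- (false , just j) = x'_j, (true , just j) = y'_j.
HV : ℕ → Set
HV t = Bool × Maybe (Fin t)

-- Adjacency of H_{1,t}: edges x₁y₁, x'_j y'_j, x₁x'_j, y₁y'_j.
hadj : ∀ {t} → HV t → HV t → Bool
hadj (b , nothing) (c , nothing) = b xor c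
hadj (b , just i)  (c , just j)  = (b xor c) ∧ ⌊ i ≟ j ⌋
hadj (b , nothing) (c , just j)  = not (b xor c)
hadj (b , just i)  (c , nothing) = not (b xor c)

record Subgraph {n} (G : SimpleGraph n) : Set where
  constructor subgraph
  field
    verts : Subset n
    edges : Vec (Vec Bool n) n

SEdge : ∀ {n} {G : SimpleGraph n} → Subgraph G → Fin n → Fin n → Bool
SEdge S i j = lookup (lookup (Subgraph.edges S) i) j

IsSubgraph : ∀ {n} (G : SimpleGraph n) → Subgraph G → Set
IsSubgraph G S =
  (∀ i j → SEdge S i j ≡ SEdge S j i) ×
  (∀ i j → SEdge S i j ≡ true → adj G i j ≡ true) ×
  (∀ i j → SEdge S i j ≡ true → i ∈ Subgraph.verts S × j ∈ Subgraph.verts S)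

IsoToH : ∀ {n} {G : SimpleGraph n} (t : ℕ) → Subgraph G → Set
IsoToH {n} t S =
  Σ (HV t ↔ Σ (Fin n) (λ v → v ∈ Subgraph.verts S)) λ φ →
    ∀ u v → hadj u v ≡ SEdge S (proj₁ (Inverse.to φ u)) (proj₁ (Inverse.to φ v))

IsCopy : ∀ {n} (G : SimpleGraph n) (t : ℕ) → Subgraph G → Set
IsCopy G t S = IsSubgraph G S × IsoToH t S

AtLeastCopies : ∀ {n} (G : SimpleGraph n) (t : ℕ) → ℕ → Set
AtLeastCopies G t k =
  Σ (List (Subgraph G)) λ L → Unique L × All (IsCopy G t) L × k ≤ length L

-- Let a, α, β be the 0/1 adjacency and side indicators, E the number of edges and H the number
-- of walks x v w y closing an edge xy with x ∈ A.  Two Cauchy–Schwarz steps give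
-- E⁴ ≤ |A|²|B|² H, and the density hypothesis makes Σ_{x∈A} d(x)² and Σ_{y∈B} d(y)² at most H/32t.
-- For an edge xy with x ∈ A, weight each neighbour v ≠ y of x by (number of common neighbours
-- w ≠ x of v and y) − t and cut these neighbours greedily into t classes of weight ≥ θ(xy).
-- Choosing v_j in the j-th class and a common neighbour w_j of v_j and y, distinct from x and
-- the earlier w_i, gives at least θ(xy)^t copies of H_{1,t} through xy, pairwise distinct since
-- x and y are the only vertices of degree ≥ 3 in a copy when t ≥ 2; on the other hand the walks
-- x v w y number at most tθ(xy) + (t+1)(d(x) + d(y)) + t.  Summing over the edges gives
-- H ≤ 2t Σθ, and the power-mean inequality (Σθ)^t ≤ E^(t-1) Σθ^t with t^t ≤ 4^t t! finishes.
-- For t = 1 the copies are the 4-cycles, counted directly via H ≤ 4·#C₄ + Σ d².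

module Submission where

open import Defs
open import Data.Nat using (ℕ; _+_; _*_; _^_; _≤_; _!)
open import Data.Fin.Subset using (Subset; ∁; ∣_∣)
open import Data.Product using (Σ; _×_)
open import Data.Bool using (Bool)
open import Data.Fin using (Fin)
open import Data.List using (List)
open import Data.List.Relation.Unary.Unique.Propositional using (Unique)
open import Relation.Binary.Definitions using (DecidableEquality)

module Sums where

  open import Data.Nat
  open import Data.Nat.Properties
  open import Data.Bool using (Bool; true; false; _∧_)
  open import Data.Fin using (Fin; zero; suc)
  open import Data.List using (List; []; _∷_; map; concatMap; _++_; length; tabulate; allFin; filter)
  open import Relation.Binary.PropositionalEquality
  open import Relation.Nullary using (Dec; yes; no; does)
  open import Algebra.Properties.CommutativeSemigroup +-commutativeSemigroup using () renaming (interchange to +-interchange)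

  ∑ : {A : Set} → List A → (A → ℕ) → ℕ
  ∑ [] f = 0
  ∑ (x ∷ L) f = f x + ∑ L f

  ∑ᶠ : (n : ℕ) → (Fin n → ℕ) → ℕ
  ∑ᶠ n = ∑ (allFin n)

  𝟙 : Bool → ℕ
  𝟙 true = 1
  𝟙 false = 0

  𝟙≤1 : ∀ b → 𝟙 b ≤ 1
  𝟙≤1 true = ≤-refl
  𝟙≤1 false = z≤n

  𝟙-idem : ∀ b → 𝟙 b * 𝟙 b ≡ 𝟙 b
  𝟙-idem true = refl
  𝟙-idem false = refl

  𝟙-∧ : ∀ a b → 𝟙 (a ∧ b) ≡ 𝟙 a * 𝟙 b
  𝟙-∧ true b = sym (+-identityʳ (𝟙 b))
  𝟙-∧ false b = refl

  m≤m∸n+n : ∀ m n → m ≤ m ∸ n + n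
  m≤m∸n+n m n with m ≤? n
  ... | yes m≤n = subst (m ≤_) (cong (_+ n) (sym (m≤n⇒m∸n≡0 m≤n))) m≤n
  ... | no m≰n = ≤-reflexive (sym (m∸n+n≡m (≰⇒≥ m≰n)))

  module _ {A : Set} where
    ∑-cong : (L : List A) {f g : A → ℕ} → (∀ x → f x ≡ g x) → ∑ L f ≡ ∑ L g
    ∑-cong [] e = refl
    ∑-cong (x ∷ L) e = cong₂ _+_ (e x) (∑-cong L e)

    ∑-mono : (L : List A) {f g : A → ℕ} → (∀ x → f x ≤ g x) → ∑ L f ≤ ∑ L g
    ∑-mono [] e = z≤n
    ∑-mono (x ∷ L) e = +-mono-≤ (e x) (∑-mono L e)

    ∑-+ : (L : List A) (f g : A → ℕ) → ∑ L (λ x → f x + g x) ≡ ∑ L f + ∑ L g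
    ∑-+ [] f g = refl
    ∑-+ (x ∷ L) f g rewrite ∑-+ L f g = +-interchange (f x) (g x) (∑ L f) (∑ L g)

    ∑-*l : (L : List A) (c : ℕ) (f : A → ℕ) → ∑ L (λ x → c * f x) ≡ c * ∑ L f
    ∑-*l [] c f = sym (*-zeroʳ c)
    ∑-*l (x ∷ L) c f rewrite ∑-*l L c f = sym (*-distribˡ-+ c (f x) (∑ L f))

    ∑-*r : (L : List A) (c : ℕ) (f : A → ℕ) → ∑ L (λ x → f x * c) ≡ ∑ L f * c
    ∑-*r L c f = trans (∑-cong L (λ x → *-comm (f x) c)) (trans (∑-*l L c f) (*-comm c (∑ L f)))

    ∑-0 : (L : List A) → ∑ L (λ _ → 0) ≡ 0
    ∑-0 [] = refl
    ∑-0 (x ∷ L) = ∑-0 L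

    ∑-const : (L : List A) (c : ℕ) → ∑ L (λ _ → c) ≡ length L * c
    ∑-const [] c = refl
    ∑-const (x ∷ L) c = cong (c +_) (∑-const L c)

    ∑-++ : (L M : List A) (f : A → ℕ) → ∑ (L ++ M) f ≡ ∑ L f + ∑ M f
    ∑-++ [] M f = refl
    ∑-++ (x ∷ L) M f rewrite ∑-++ L M f = sym (+-assoc (f x) (∑ L f) (∑ M f))

    ∑-∸ : (L : List A) (f g : A → ℕ) → ∑ L f ≤ ∑ L (λ x → f x ∸ g x) + ∑ L g
    ∑-∸ [] f g = z≤n
    ∑-∸ (x ∷ L) f g = begin
        f x + ∑ L f
      ≤⟨ +-mono-≤ (m≤m∸n+n (f x) (g x)) (∑-∸ L f g) ⟩
        (f x ∸ g x + g x) + (∑ L (λ x → f x ∸ g x) + ∑ L g)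
      ≡⟨ +-interchange (f x ∸ g x) (g x) (∑ L (λ x → f x ∸ g x)) (∑ L g) ⟩
        (f x ∸ g x + ∑ L (λ x → f x ∸ g x)) + (g x + ∑ L g) ∎
      where open ≤-Reasoning

    length≡∑1 : (L : List A) → length L ≡ ∑ L (λ _ → 1)
    length≡∑1 [] = refl
    length≡∑1 (x ∷ L) = cong suc (length≡∑1 L)

    length-filter : {P : A → Set} (P? : ∀ x → Dec (P x)) (L : List A) →
      length (filter P? L) ≡ ∑ L (λ x → 𝟙 (does (P? x)))
    length-filter P? [] = refl
    length-filter P? (x ∷ L) with does (P? x)
    ... | true = cong suc (length-filter P? L)
    ... | false = length-filter P? L

    ∑-filter : {P : A → Set} (P? : ∀ x → Dec (P x)) (L : List A) (f : A → ℕ) →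
      ∑ (filter P? L) f ≡ ∑ L (λ x → 𝟙 (does (P? x)) * f x)
    ∑-filter P? [] f = refl
    ∑-filter P? (x ∷ L) f with P? x
    ... | yes _ = cong₂ _+_ (sym (+-identityʳ (f x))) (∑-filter P? L f)
    ... | no _ = ∑-filter P? L f

  module _ {A B : Set} where
    ∑-swap : (L : List A) (M : List B) (f : A → B → ℕ) →
      ∑ L (λ x → ∑ M (λ y → f x y)) ≡ ∑ M (λ y → ∑ L (λ x → f x y))
    ∑-swap [] M f = sym (∑-0 M)
    ∑-swap (x ∷ L) M f rewrite ∑-swap L M f = sym (∑-+ M (f x) (λ y → ∑ L (λ x → f x y)))

    ∑*∑ : (L : List A) (M : List B) (f : A → ℕ) (h : B → ℕ) → ∑ L f * ∑ M h ≡ ∑ L (λ i → ∑ M (λ j → f i * h j))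
    ∑*∑ [] M f h = refl
    ∑*∑ (x ∷ L) M f h = trans (*-distribʳ-+ (∑ M h) (f x) (∑ L f))
      (cong₂ _+_ (sym (∑-*l M (f x) h)) (∑*∑ L M f h))

    ∑-map : (L : List A) (g : A → B) (f : B → ℕ) → ∑ (map g L) f ≡ ∑ L (λ x → f (g x))
    ∑-map [] g f = refl
    ∑-map (x ∷ L) g f = cong (f (g x) +_) (∑-map L g f)

    ∑-concatMap : (L : List A) (h : A → List B) (f : B → ℕ) → ∑ (concatMap h L) f ≡ ∑ L (λ x → ∑ (h x) f)
    ∑-concatMap [] h f = refl
    ∑-concatMap (x ∷ L) h f rewrite ∑-++ (h x) (concatMap h L) f = cong (∑ (h x) f +_) (∑-concatMap L h f)

    length-concatMap : (L : List A) (h : A → List B) → length (concatMap h L) ≡ ∑ L (λ x → length (h x))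
    length-concatMap L h = trans (length≡∑1 (concatMap h L))
      (trans (∑-concatMap L h (λ _ → 1)) (∑-cong L (λ x → sym (length≡∑1 (h x)))))

  ∑-tabulate : {A : Set} (n : ℕ) (g : Fin n → A) (f : A → ℕ) → ∑ (tabulate g) f ≡ ∑ᶠ n (λ i → f (g i))
  ∑-tabulate zero g f = refl
  ∑-tabulate (suc n) g f = cong (f (g zero) +_)
    (trans (∑-tabulate n (λ i → g (suc i)) f) (sym (∑-tabulate n suc (λ i → f (g i)))))

  ∑ᶠ-suc : (n : ℕ) (f : Fin (suc n) → ℕ) → ∑ᶠ (suc n) f ≡ f zero + ∑ᶠ n (λ i → f (suc i))
  ∑ᶠ-suc n f = cong (f zero +_) (∑-tabulate n suc f)

module PowerMean where

  open import Data.Nat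
  open import Data.Nat.Properties
  open import Data.List using (List)
  open import Data.Product using (_,_)
  open import Data.Sum using (inj₁; inj₂)
  open import Relation.Binary.PropositionalEquality
  open import Data.Nat.Tactic.RingSolver
  open Sums

  -- (a^m − b^m)(a − b) ≥ 0, with the products expanded so that nothing is subtracted.
  ^-rearrangement-≤ : ∀ m a b → a ≤ b → a ^ m * b + b ^ m * a ≤ a ^ suc m + b ^ suc m
  ^-rearrangement-≤ m a b a≤b with m≤n⇒∃[o]m+o≡n a≤b
  ... | d , refl = begin
      a ^ m * (a + d) + (a + d) ^ m * a
    ≡⟨ e1 (a ^ m) ((a + d) ^ m) a d ⟩
      (a * a ^ m + (a + d) ^ m * a) + a ^ m * d
    ≤⟨ +-monoʳ-≤ (a * a ^ m + (a + d) ^ m * a) (*-monoˡ-≤ d (^-monoˡ-≤ m (m≤m+n a d))) ⟩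
      (a * a ^ m + (a + d) ^ m * a) + (a + d) ^ m * d
    ≡⟨ e2 (a ^ m) ((a + d) ^ m) a d ⟩
      a * a ^ m + (a + d) * (a + d) ^ m ∎
    where
    open ≤-Reasoning
    e1 : ∀ p q a d → p * (a + d) + q * a ≡ (a * p + q * a) + p * d
    e1 = solve-∀
    e2 : ∀ p q a d → (a * p + q * a) + q * d ≡ a * p + (a + d) * q
    e2 = solve-∀

  ^-rearrangement : ∀ m a b → a ^ m * b + b ^ m * a ≤ a ^ suc m + b ^ suc m
  ^-rearrangement m a b with ≤-total a b
  ... | inj₁ a≤b = ^-rearrangement-≤ m a b a≤b
  ... | inj₂ b≤a = subst₂ _≤_ (+-comm (b ^ m * a) (a ^ m * b)) (+-comm (b ^ suc m) (a ^ suc m)) (^-rearrangement-≤ m b a b≤a)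

  module _ {A : Set} where
    ∑∑ : (L : List A) → (A → A → ℕ) → ℕ
    ∑∑ L F = ∑ L (λ i → ∑ L (λ j → F i j))

    ∑∑-symmetrise : (L : List A) → ∀ F → 2 * ∑∑ L F ≡ ∑ L (λ i → ∑ L (λ j → F i j + F j i))
    ∑∑-symmetrise L F = begin
        2 * ∑∑ L F
      ≡⟨ cong (∑∑ L F +_) (+-identityʳ (∑∑ L F)) ⟩
        ∑∑ L F + ∑∑ L F
      ≡⟨ cong (∑∑ L F +_) (∑-swap L L F) ⟩
        ∑∑ L F + ∑ L (λ i → ∑ L (λ j → F j i))
      ≡⟨ sym (∑-+ L _ _) ⟩
        ∑ L (λ i → ∑ L (λ j → F i j) + ∑ L (λ j → F j i))
      ≡⟨ ∑-cong L (λ i → sym (∑-+ L _ _)) ⟩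
        ∑ L (λ i → ∑ L (λ j → F i j + F j i)) ∎
      where open ≡-Reasoning

    ∑∑-mono-symmetric : (L : List A) (F G : A → A → ℕ) → (∀ i j → F i j + F j i ≤ G i j + G j i) →
      ∑ L (λ i → ∑ L (λ j → F i j)) ≤ ∑ L (λ i → ∑ L (λ j → G i j))
    ∑∑-mono-symmetric L F G h = *-cancelˡ-≤ 2 (begin
        2 * ∑∑ L F
      ≡⟨ ∑∑-symmetrise L F ⟩
        ∑ L (λ i → ∑ L (λ j → F i j + F j i))
      ≤⟨ ∑-mono L (λ i → ∑-mono L (λ j → h i j)) ⟩
        ∑ L (λ i → ∑ L (λ j → G i j + G j i))
      ≡⟨ sym (∑∑-symmetrise L G) ⟩
        2 * ∑∑ L G ∎)
      where
      open ≤-Reasoning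

    chebyshev-step : (L : List A) (g q : A → ℕ) (m : ℕ) →
      ∑ L (λ i → g i * q i ^ m) * ∑ L (λ i → g i * q i) ≤ ∑ L g * ∑ L (λ i → g i * q i ^ suc m)
    chebyshev-step L g q m = begin
        ∑ L (λ i → g i * q i ^ m) * ∑ L (λ i → g i * q i)
      ≡⟨ ∑*∑ L L _ _ ⟩
        ∑ L (λ i → ∑ L (λ j → (g i * q i ^ m) * (g j * q j)))
      ≤⟨ ∑∑-mono-symmetric L _ _ pt ⟩
        ∑ L (λ i → ∑ L (λ j → g i * (g j * q j ^ suc m)))
      ≡⟨ sym (∑*∑ L L _ _) ⟩
        ∑ L g * ∑ L (λ i → g i * q i ^ suc m) ∎
      where
      open ≤-Reasoning
      pt : ∀ i j → (g i * q i ^ m) * (g j * q j) + (g j * q j ^ m) * (g i * q i)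
                 ≤ g i * (g j * q j ^ suc m) + g j * (g i * q i ^ suc m)
      pt i j = begin
          (g i * q i ^ m) * (g j * q j) + (g j * q j ^ m) * (g i * q i)
        ≡⟨ e1 (g i) (g j) (q i ^ m) (q j ^ m) (q i) (q j) ⟩
          (g i * g j) * (q i ^ m * q j + q j ^ m * q i)
        ≤⟨ *-monoʳ-≤ (g i * g j) (^-rearrangement m (q i) (q j)) ⟩
          (g i * g j) * (q i * q i ^ m + q j * q j ^ m)
        ≡⟨ e2 (g i) (g j) (q i ^ m) (q j ^ m) (q i) (q j) ⟩
          g i * (g j * (q j * q j ^ m)) + g j * (g i * (q i * q i ^ m)) ∎
        where
        e1 : ∀ gi gj pi pj qi qj → (gi * pi) * (gj * qj) + (gj * pj) * (gi * qi) ≡ (gi * gj) * (pi * qj + pj * qi)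
        e1 = solve-∀
        e2 : ∀ gi gj pi pj qi qj → (gi * gj) * (qi * pi + qj * pj) ≡ gi * (gj * (qj * pj)) + gj * (gi * (qi * pi))
        e2 = solve-∀

    power-mean : (L : List A) (g q : A → ℕ) (k : ℕ) →
      ∑ L (λ i → g i * q i) ^ suc k ≤ ∑ L g ^ k * ∑ L (λ i → g i * q i ^ suc k)
    power-mean L g q zero = ≤-reflexive (trans (*-identityʳ _) (trans (∑-cong L (λ i → cong (g i *_) (sym (*-identityʳ (q i))))) (sym (+-identityʳ _))))
    power-mean L g q (suc k) = begin
        P * P ^ suc k
      ≤⟨ *-monoʳ-≤ P (power-mean L g q k) ⟩
        P * (∑ L g ^ k * ∑ L (λ i → g i * q i ^ suc k))
      ≡⟨ e (∑ L g ^ k) P (∑ L (λ i → g i * q i ^ suc k)) ⟩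
        ∑ L g ^ k * (∑ L (λ i → g i * q i ^ suc k) * P)
      ≤⟨ *-monoʳ-≤ (∑ L g ^ k) (chebyshev-step L g q (suc k)) ⟩
        ∑ L g ^ k * (∑ L g * ∑ L (λ i → g i * q i ^ suc (suc k)))
      ≡⟨ e' (∑ L g ^ k) (∑ L g) _ ⟩
        (∑ L g * ∑ L g ^ k) * ∑ L (λ i → g i * q i ^ suc (suc k)) ∎
      where
      open ≤-Reasoning
      P = ∑ L (λ i → g i * q i)
      e : ∀ x p y → p * (x * y) ≡ x * (y * p)
      e = solve-∀
      e' : ∀ x s y → x * (s * y) ≡ (s * x) * y
      e' = solve-∀

module FactorialBound where

  open import Data.Nat
  open import Data.Nat.Properties
  open import Data.Product using (_,_)
  open import Relation.Binary.PropositionalEquality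
  open import Data.Nat.Tactic.RingSolver

  -- (1 + 1/t)^k ≤ 2 when 2k ≤ t + 1; applied to two halves of t it gives (1 + 1/t)^t ≤ 4.
  [1+t]^k*r≤t^k*[1+t] : ∀ t k r → k + r ≡ suc t → (suc t) ^ k * r ≤ t ^ k * suc t
  [1+t]^k*r≤t^k*[1+t] t zero r e rewrite e = ≤-refl
  [1+t]^k*r≤t^k*[1+t] t (suc k) r e = begin
      (suc t * suc t ^ k) * r
    ≡⟨ e1 (suc t) (suc t ^ k) r ⟩
      suc t ^ k * (suc t * r)
    ≤⟨ *-monoʳ-≤ (suc t ^ k) h ⟩
      suc t ^ k * (t * suc r)
    ≡⟨ e2 (suc t ^ k) t (suc r) ⟩
      t * (suc t ^ k * suc r)
    ≤⟨ *-monoʳ-≤ t ([1+t]^k*r≤t^k*[1+t] t k (suc r) (trans (+-suc k r) e)) ⟩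
      t * (t ^ k * suc t)
    ≡⟨ sym (*-assoc t (t ^ k) (suc t)) ⟩
      (t * t ^ k) * suc t ∎
    where
    open ≤-Reasoning
    e1 : ∀ a b r → (a * b) * r ≡ b * (a * r)
    e1 = solve-∀
    e2 : ∀ a t r → a * (t * r) ≡ t * (a * r)
    e2 = solve-∀
    r≤t : r ≤ t
    r≤t = subst (r ≤_) (suc-injective e) (m≤n+m r k)
    h : suc t * r ≤ t * suc r
    h = begin
        suc t * r ≡⟨⟩ r + t * r ≤⟨ +-monoˡ-≤ (t * r) r≤t ⟩ t + t * r ≡⟨ sym (*-suc t r) ⟩ t * suc r ∎

  [1+t]^k≤2*t^k : ∀ t k → k + k ≤ suc t → (suc t) ^ k ≤ 2 * t ^ k
  [1+t]^k≤2*t^k t k kk with m≤n⇒∃[o]m+o≡n (≤-trans (m≤m+n k k) kk)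
  ... | r , e = *-cancelʳ-≤ _ _ (suc t) (begin
      suc t ^ k * suc t
    ≤⟨ *-monoʳ-≤ (suc t ^ k) st≤ ⟩
      suc t ^ k * (2 * r)
    ≡⟨ e1 (suc t ^ k) r ⟩
      2 * (suc t ^ k * r)
    ≤⟨ *-monoʳ-≤ 2 ([1+t]^k*r≤t^k*[1+t] t k r e) ⟩
      2 * (t ^ k * suc t)
    ≡⟨ sym (*-assoc 2 (t ^ k) (suc t)) ⟩
      2 * t ^ k * suc t ∎)
    where
    open ≤-Reasoning
    k≤r : k ≤ r
    k≤r = +-cancelˡ-≤ k k r (subst (k + k ≤_) (sym e) kk)
    st≤ : suc t ≤ 2 * r
    st≤ = subst (_≤ 2 * r) e (subst (k + r ≤_) (cong (r +_) (sym (+-identityʳ r))) (+-monoˡ-≤ r k≤r))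
    e1 : ∀ a b → a * (2 * b) ≡ 2 * (a * b)
    e1 = solve-∀

  halves : ∀ t → Σ ℕ λ h1 → Σ ℕ λ h2 → (h1 + h2 ≡ t) × (h1 + h1 ≤ suc t) × (h2 + h2 ≤ suc t)
  halves zero = 0 , 0 , refl , z≤n , z≤n
  halves (suc zero) = 0 , 1 , refl , z≤n , ≤-refl
  halves (suc (suc t)) with halves t
  ... | h1 , h2 , e , c1 , c2 = suc h1 , suc h2 , cong suc (trans (+-suc h1 h2) (cong suc e)) ,
     s≤s (subst (_≤ suc (suc t)) (sym (+-suc h1 h1)) (s≤s c1)) ,
     s≤s (subst (_≤ suc (suc t)) (sym (+-suc h2 h2)) (s≤s c2))

  [1+t]^t≤4*t^t : ∀ t → (suc t) ^ t ≤ 4 * t ^ t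
  [1+t]^t≤4*t^t t with halves t
  ... | h1 , h2 , eq , c1 , c2 = begin
      suc t ^ t
    ≡⟨ cong (suc t ^_) (sym eq) ⟩
      suc t ^ (h1 + h2)
    ≡⟨ ^-distribˡ-+-* (suc t) h1 h2 ⟩
      suc t ^ h1 * suc t ^ h2
    ≤⟨ *-mono-≤ ([1+t]^k≤2*t^k t h1 c1) ([1+t]^k≤2*t^k t h2 c2) ⟩
      (2 * t ^ h1) * (2 * t ^ h2)
    ≡⟨ e1 (t ^ h1) (t ^ h2) ⟩
      4 * (t ^ h1 * t ^ h2)
    ≡⟨ cong (4 *_) (sym (^-distribˡ-+-* t h1 h2)) ⟩
      4 * t ^ (h1 + h2)
    ≡⟨ cong (λ z → 4 * t ^ z) eq ⟩
      4 * t ^ t ∎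
    where
    open ≤-Reasoning
    e1 : ∀ a b → (2 * a) * (2 * b) ≡ 4 * (a * b)
    e1 = solve-∀

  t^t≤4^t*t! : ∀ t → t ^ t ≤ 4 ^ t * t !
  t^t≤4^t*t! zero = ≤-refl
  t^t≤4^t*t! (suc t) = begin
      suc t * suc t ^ t
    ≤⟨ *-monoʳ-≤ (suc t) ([1+t]^t≤4*t^t t) ⟩
      suc t * (4 * t ^ t)
    ≤⟨ *-monoʳ-≤ (suc t) (*-monoʳ-≤ 4 (t^t≤4^t*t! t)) ⟩
      suc t * (4 * (4 ^ t * t !))
    ≡⟨ e1 (suc t) (4 ^ t) (t !) ⟩
      (4 * 4 ^ t) * (suc t * t !) ∎
    where
    open ≤-Reasoning
    e1 : ∀ a b c → a * (4 * (b * c)) ≡ (4 * b) * (a * c)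
    e1 = solve-∀

module Embedding where

  open import Data.Nat using (ℕ)
  open import Data.Bool using (Bool; true; false; not; _∧_; if_then_else_)
  open import Data.Bool.Properties using (xor-comm)
  open import Data.Fin using (Fin; _≟_) renaming (suc to fsuc)
  open import Data.Fin.Subset using (_∈_)
  open import Data.Maybe using (Maybe; just; nothing; is-just)
  open import Data.Product using (Σ; _×_; _,_; proj₁)
  open import Data.List using (List; []; _∷_; map; _++_; allFin)
  open import Data.List.Membership.Propositional using () renaming (_∈_ to _∈ₗ_)
  open import Data.List.Membership.Propositional.Properties using (∈-map⁺; ∈-++⁺ˡ; ∈-++⁺ʳ; ∈-allFin)
  open import Data.List.Relation.Unary.Any using (here; there)
  open import Data.Vec using (Vec; tabulate; lookup)
  open import Data.Vec.Properties using (lookup∘tabulate; []=⇒lookup; lookup⇒[]=)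
  open import Data.Vec.Properties.WithK using ([]=-irrelevant)
  open import Function.Bundles using (_↔_; Inverse; mk↔ₛ′)
  open import Relation.Binary.PropositionalEquality
  open import Relation.Nullary using (¬_; yes; no)
  open import Relation.Nullary.Decidable using (⌊_⌋)
  open import Data.Empty using (⊥; ⊥-elim)

  false≢true : false ≡ true → ⊥
  false≢true ()

  infix 5 _==_
  _==_ : ∀ {n} → Fin n → Fin n → Bool
  i == j = ⌊ i ≟ j ⌋

  ==⇒≡ : ∀ {n} (i j : Fin n) → i == j ≡ true → i ≡ j
  ==⇒≡ i j e with i ≟ j
  ... | yes p = p
  ... | no _ = ⊥-elim (false≢true e)

  ==-refl : ∀ {n} (i : Fin n) → i == i ≡ true
  ==-refl i with i ≟ i
  ... | yes _ = refl
  ... | no p = ⊥-elim (p refl)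

  ==-false⇒≢ : ∀ {n} {i j : Fin n} → i == j ≡ false → ¬ i ≡ j
  ==-false⇒≢ {i = i} i==j refl = false≢true (trans (sym i==j) (==-refl i))

  ==-sym : ∀ {n} (i j : Fin n) → i == j ≡ j == i
  ==-sym i j with i ≟ j | j ≟ i
  ... | yes _ | yes _ = refl
  ... | no _ | no _ = refl
  ... | yes p | no q = ⊥-elim (q (sym p))
  ... | no p | yes q = ⊥-elim (p (sym q))

  fsuc-== : ∀ {n} (i j : Fin n) → fsuc i == fsuc j ≡ i == j
  fsuc-== i j with i ≟ j
  ... | yes _ = refl
  ... | no _ = refl

  hadj-sym : ∀ {t} (u v : HV t) → hadj u v ≡ hadj v u
  hadj-sym (false , nothing) (false , nothing) = refl
  hadj-sym (false , nothing) (true , nothing) = refl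
  hadj-sym (true , nothing) (false , nothing) = refl
  hadj-sym (true , nothing) (true , nothing) = refl
  hadj-sym (b , nothing) (c , just j) = cong not (xor-comm b c)
  hadj-sym (b , just i) (c , nothing) = cong not (xor-comm b c)
  hadj-sym (b , just i) (c , just j) = cong₂ _∧_ (xor-comm b c) (==-sym i j)

  allHV : (t : ℕ) → List (HV t)
  allHV t = (false , nothing) ∷ (true , nothing) ∷
    (map (λ j → (false , just j)) (allFin t) ++ map (λ j → (true , just j)) (allFin t))

  allHV-complete : ∀ {t} (u : HV t) → u ∈ₗ allHV t
  allHV-complete (false , nothing) = here refl
  allHV-complete (true , nothing) = there (here refl)
  allHV-complete (false , just j) = there (there (∈-++⁺ˡ (∈-map⁺ (λ j → (false , just j)) (∈-allFin j))))
  allHV-complete {t} (true , just j) =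
    there (there (∈-++⁺ʳ (map (λ j → (false , just j)) (allFin t)) (∈-map⁺ (λ j → (true , just j)) (∈-allFin j))))

  fromJust : ∀ {X : Set} (m : Maybe X) → is-just m ≡ true → X
  fromJust (just x) _ = x

  fromJust-correct : ∀ {X : Set} (m : Maybe X) (e : is-just m ≡ true) → m ≡ just (fromJust m e)
  fromJust-correct (just x) e = refl

  just-injective : ∀ {X : Set} {a b : X} → just a ≡ just b → a ≡ b
  just-injective refl = refl

  module ImageOf {n} (G : SimpleGraph n) (t : ℕ) (x y : Fin n) (f g : Fin t → Fin n) where

    φ : HV t → Fin n
    φ (false , nothing) = x
    φ (true , nothing) = y
    φ (false , just j) = f j
    φ (true , just j) = g j

    preimageIn : List (HV t) → Fin n → Maybe (HV t)
    preimageIn [] i = nothing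
    preimageIn (u ∷ L) i = if φ u == i then just u else preimageIn L i

    preimage : Fin n → Maybe (HV t)
    preimage = preimageIn (allHV t)

    preimageIn-sound : ∀ L i u → preimageIn L i ≡ just u → φ u ≡ i
    preimageIn-sound (u' ∷ L) i u e with φ u' == i in eq
    ... | true = trans (cong φ (sym (just-injective e))) (==⇒≡ _ _ eq)
    ... | false = preimageIn-sound L i u e

    preimage-sound : ∀ i u → preimage i ≡ just u → φ u ≡ i
    preimage-sound = preimageIn-sound (allHV t)

    imageAdj : Fin n → Fin n → Bool
    imageAdj i j with preimage i | preimage j
    ... | just u | just v = hadj u v
    ... | _ | _ = false

    inImage : Fin n → Bool
    inImage i = is-just (preimage i)

    image : Subgraph G
    image = subgraph (tabulate inImage) (tabulate (λ i → tabulate (λ j → imageAdj i j)))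

    SEdge-image : ∀ i j → SEdge image i j ≡ imageAdj i j
    SEdge-image i j = trans (cong (λ r → lookup r j) (lookup∘tabulate (λ i → tabulate (λ j → imageAdj i j)) i))
                            (lookup∘tabulate (imageAdj i) j)

    imageAdj-sym : ∀ i j → imageAdj i j ≡ imageAdj j i
    imageAdj-sym i j with preimage i | preimage j
    ... | just u | just v = hadj-sym u v
    ... | just u | nothing = refl
    ... | nothing | just v = refl
    ... | nothing | nothing = refl

    imageAdj-true : ∀ i j → imageAdj i j ≡ true →
      Σ (HV t) λ u → Σ (HV t) λ v → (preimage i ≡ just u) × (preimage j ≡ just v) × (hadj u v ≡ true)
    imageAdj-true i j e with preimage i | preimage j
    ... | just u | just v = u , v , refl , refl , e
    ... | just u | nothing = ⊥-elim (false≢true e)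
    ... | nothing | just v = ⊥-elim (false≢true e)
    ... | nothing | nothing = ⊥-elim (false≢true e)

    Verts : Set
    Verts = Σ (Fin n) (λ v → v ∈ Subgraph.verts image)

    Verts-≡ : ∀ {i i'} {p : i ∈ Subgraph.verts image} {p' : i' ∈ Subgraph.verts image} →
      i ≡ i' → _≡_ {A = Verts} (i , p) (i' , p')
    Verts-≡ refl = cong (_ ,_) ([]=-irrelevant _ _)

    inImage⇒∈ : ∀ i → inImage i ≡ true → i ∈ Subgraph.verts image
    inImage⇒∈ i e = lookup⇒[]= i _ (trans (lookup∘tabulate inImage i) e)

    ∈⇒inImage : ∀ i → i ∈ Subgraph.verts image → inImage i ≡ true
    ∈⇒inImage i p = trans (sym (lookup∘tabulate inImage i)) ([]=⇒lookup p)

    module Injective (φ-injective : ∀ u v → φ u ≡ φ v → u ≡ v)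
                     (φ-hom : ∀ u v → hadj u v ≡ true → adj G (φ u) (φ v) ≡ true) where

      preimageIn-complete : ∀ L u → u ∈ₗ L → preimageIn L (φ u) ≡ just u
      preimageIn-complete (u' ∷ L) u (here refl) rewrite ==-refl (φ u) = refl
      preimageIn-complete (u' ∷ L) u (there m) with φ u' == φ u in eq
      ... | true = cong just (φ-injective u' u (==⇒≡ _ _ eq))
      ... | false = preimageIn-complete L u m

      preimage-φ : ∀ u → preimage (φ u) ≡ just u
      preimage-φ u = preimageIn-complete (allHV t) u (allHV-complete u)

      imageAdj-φ : ∀ u v → imageAdj (φ u) (φ v) ≡ hadj u v
      imageAdj-φ u v with preimage (φ u) | preimage (φ v) | preimage-φ u | preimage-φ v
      ... | just .u | just .v | refl | refl = refl

      inImage-φ : ∀ u → inImage (φ u) ≡ true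
      inImage-φ u rewrite preimage-φ u = refl

      φ↔Verts : HV t ↔ Verts
      φ↔Verts = mk↔ₛ′ to from to∘from from∘to
        where
        to : HV t → Verts
        to u = φ u , inImage⇒∈ (φ u) (inImage-φ u)
        from : Verts → HV t
        from (i , p) = fromJust (preimage i) (∈⇒inImage i p)
        to∘from : ∀ w → to (from w) ≡ w
        to∘from (i , p) = Verts-≡ (preimage-sound i _ (fromJust-correct (preimage i) (∈⇒inImage i p)))
        from∘to : ∀ u → from (to u) ≡ u
        from∘to u = just-injective (trans (sym (fromJust-correct (preimage (φ u)) _)) (preimage-φ u))

      image-isCopy : IsCopy G t image
      image-isCopy = (symmetric , edges⊆G , edges⊆verts) , φ↔Verts , hadj≡SEdge
        where
        symmetric : ∀ i j → SEdge image i j ≡ SEdge image j i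
        symmetric i j = trans (SEdge-image i j) (trans (imageAdj-sym i j) (sym (SEdge-image j i)))
        edges⊆G : ∀ i j → SEdge image i j ≡ true → adj G i j ≡ true
        edges⊆G i j e with imageAdj-true i j (trans (sym (SEdge-image i j)) e)
        ... | u , v , eu , ev , h =
          subst₂ (λ a b → adj G a b ≡ true) (preimage-sound i u eu) (preimage-sound j v ev) (φ-hom u v h)
        edges⊆verts : ∀ i j → SEdge image i j ≡ true → i ∈ Subgraph.verts image × j ∈ Subgraph.verts image
        edges⊆verts i j e with imageAdj-true i j (trans (sym (SEdge-image i j)) e)
        ... | u , v , eu , ev , h = inImage⇒∈ i (cong is-just eu) , inImage⇒∈ j (cong is-just ev)
        hadj≡SEdge : ∀ u v → hadj u v ≡ SEdge image (proj₁ (Inverse.to φ↔Verts u)) (proj₁ (Inverse.to φ↔Verts v))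
        hadj≡SEdge u v = sym (trans (SEdge-image (φ u) (φ v)) (imageAdj-φ u v))

module Placements where

  open Embedding
  open import Data.Nat using (ℕ)
  open import Data.Bool using (Bool; true; false; not)
  open import Data.Fin using (Fin)
  open import Data.Maybe using (just; nothing)
  open import Data.Product using (Σ; _×_; _,_)
  open import Relation.Binary.PropositionalEquality
  open import Relation.Nullary using (¬_)
  open import Data.Empty using (⊥; ⊥-elim)

  true≢false : true ≡ false → ⊥
  true≢false ()

  record Placement {n} (G : SimpleGraph n) (side : Fin n → Bool) (t : ℕ) (x y : Fin n) (f g : Fin t → Fin n) : Set where
    field
      x~y : adj G x y ≡ true
      x~f : ∀ j → adj G x (f j) ≡ true
      y~g : ∀ j → adj G y (g j) ≡ true
      f~g : ∀ j → adj G (f j) (g j) ≡ true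
      x∈A : side x ≡ true
      y∈B : side y ≡ false
      f∈B : ∀ j → side (f j) ≡ false
      g∈A : ∀ j → side (g j) ≡ true
      x≢g : ∀ j → ¬ x ≡ g j
      y≢f : ∀ j → ¬ y ≡ f j
      f-injective : ∀ i j → f i ≡ f j → i ≡ j
      g-injective : ∀ i j → g i ≡ g j → i ≡ j

  sideH : ∀ {t} → HV t → Bool
  sideH (b , nothing) = not b
  sideH (b , just _) = b

  module PlacementCopy {n} (G : SimpleGraph n) (side : Fin n → Bool) (t : ℕ) (x y : Fin n) (f g : Fin t → Fin n)
                       (P : Placement G side t x y f g) where
    open Placement P
    open ImageOf G t x y f g public

    side-φ : ∀ u → side (φ u) ≡ sideH u
    side-φ (false , nothing) = x∈A
    side-φ (true , nothing) = y∈B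
    side-φ (false , just j) = f∈B j
    side-φ (true , just j) = g∈A j

    φ-sideH : ∀ u v → φ u ≡ φ v → sideH u ≡ sideH v
    φ-sideH u v e = trans (sym (side-φ u)) (trans (cong side e) (side-φ v))

    φ-injective : ∀ u v → φ u ≡ φ v → u ≡ v
    φ-injective (false , nothing) (false , nothing) e = refl
    φ-injective (true , nothing) (true , nothing) e = refl
    φ-injective (false , just i) (false , just j) e = cong (λ k → false , just k) (f-injective i j e)
    φ-injective (true , just i) (true , just j) e = cong (λ k → true , just k) (g-injective i j e)
    φ-injective (false , nothing) (true , just j) e = ⊥-elim (x≢g j e)
    φ-injective (true , just j) (false , nothing) e = ⊥-elim (x≢g j (sym e))
    φ-injective (true , nothing) (false , just j) e = ⊥-elim (y≢f j e)
    φ-injective (false , just j) (true , nothing) e = ⊥-elim (y≢f j (sym e))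
    φ-injective u@(false , nothing) v@(true , nothing) e = ⊥-elim (true≢false (φ-sideH u v e))
    φ-injective u@(true , nothing) v@(false , nothing) e = ⊥-elim (true≢false (sym (φ-sideH u v e)))
    φ-injective u@(false , nothing) v@(false , just j) e = ⊥-elim (true≢false (φ-sideH u v e))
    φ-injective u@(false , just j) v@(false , nothing) e = ⊥-elim (true≢false (sym (φ-sideH u v e)))
    φ-injective u@(true , nothing) v@(true , just j) e = ⊥-elim (true≢false (sym (φ-sideH u v e)))
    φ-injective u@(true , just j) v@(true , nothing) e = ⊥-elim (true≢false (φ-sideH u v e))
    φ-injective u@(false , just i) v@(true , just j) e = ⊥-elim (true≢false (sym (φ-sideH u v e)))
    φ-injective u@(true , just i) v@(false , just j) e = ⊥-elim (true≢false (φ-sideH u v e))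

    φ-hom : ∀ u v → hadj u v ≡ true → adj G (φ u) (φ v) ≡ true
    φ-hom (false , nothing) (true , nothing) h = x~y
    φ-hom (true , nothing) (false , nothing) h = trans (symm G y x) x~y
    φ-hom (false , nothing) (false , just j) h = x~f j
    φ-hom (true , nothing) (true , just j) h = y~g j
    φ-hom (false , just j) (false , nothing) h = trans (symm G (f j) x) (x~f j)
    φ-hom (true , just j) (true , nothing) h = trans (symm G (g j) y) (y~g j)
    φ-hom (false , just i) (true , just j) h rewrite ==⇒≡ i j h = f~g j
    φ-hom (true , just i) (false , just j) h rewrite ==⇒≡ i j h = trans (symm G (g j) (f j)) (f~g j)
    φ-hom (false , nothing) (false , nothing) ()
    φ-hom (true , nothing) (true , nothing) ()
    φ-hom (false , nothing) (true , just j) ()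
    φ-hom (true , nothing) (false , just j) ()
    φ-hom (true , just j) (false , nothing) ()
    φ-hom (false , just j) (true , nothing) ()
    φ-hom (false , just i) (false , just j) ()
    φ-hom (true , just i) (true , just j) ()

    open Injective φ-injective φ-hom public

    imageAdj-neighbour : ∀ u w → imageAdj (φ u) w ≡ true → Σ (HV t) λ v → (φ v ≡ w) × (hadj u v ≡ true)
    imageAdj-neighbour u w e with imageAdj-true (φ u) w e
    ... | u' , v , eu , ev , h with trans (sym (preimage-φ u)) eu
    ... | refl = v , preimage-sound w v ev , h

    imageAdj-preimage : ∀ i w → imageAdj i w ≡ true → Σ (HV t) λ u → φ u ≡ i
    imageAdj-preimage i w e with imageAdj-true i w e
    ... | u , v , eu , ev , h = u , preimage-sound i u eu

module Recovery where

  open Embedding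
  open Placements
  open import Data.Nat using (ℕ; suc; _<_)
  open import Data.Nat.Properties using (<-asym)
  open import Data.Bool using (Bool; true; false)
  open import Data.Fin using (Fin; toℕ) renaming (zero to fzero; suc to fsuc)
  open import Data.Maybe using (just; nothing)
  open import Data.Product using (Σ; _×_; _,_; proj₂)
  open import Data.Sum using (_⊎_; inj₁; inj₂)
  open import Relation.Binary.PropositionalEquality
  open import Relation.Nullary using (¬_)
  open import Data.Empty using (⊥; ⊥-elim)

  no-three-in-two : ∀ {X : Set} {p q w₁ w₂ w₃ : X} → ¬ w₁ ≡ w₂ → ¬ w₁ ≡ w₃ → ¬ w₂ ≡ w₃ →
    (w₁ ≡ p ⊎ w₁ ≡ q) → (w₂ ≡ p ⊎ w₂ ≡ q) → (w₃ ≡ p ⊎ w₃ ≡ q) → ⊥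
  no-three-in-two n12 n13 n23 (inj₁ a) (inj₁ b) _ = n12 (trans a (sym b))
  no-three-in-two n12 n13 n23 (inj₂ a) (inj₂ b) _ = n12 (trans a (sym b))
  no-three-in-two n12 n13 n23 (inj₁ a) _ (inj₁ c) = n13 (trans a (sym c))
  no-three-in-two n12 n13 n23 (inj₂ a) _ (inj₂ c) = n13 (trans a (sym c))
  no-three-in-two n12 n13 n23 _ (inj₁ b) (inj₁ c) = n23 (trans b (sym c))
  no-three-in-two n12 n13 n23 _ (inj₂ b) (inj₂ c) = n23 (trans b (sym c))

  ordered-pair-unique : ∀ {n} {a b a' b' : Fin n} → toℕ a < toℕ b → toℕ a' < toℕ b' → ¬ a' ≡ b' →
    (a' ≡ a ⊎ a' ≡ b) → (b' ≡ a ⊎ b' ≡ b) → (a' ≡ a) × (b' ≡ b)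
  ordered-pair-unique lt lt' ne (inj₁ p) (inj₁ q) = ⊥-elim (ne (trans p (sym q)))
  ordered-pair-unique lt lt' ne (inj₁ p) (inj₂ q) = p , q
  ordered-pair-unique lt lt' ne (inj₂ p) (inj₂ q) = ⊥-elim (ne (trans p (sym q)))
  ordered-pair-unique lt lt' ne (inj₂ refl) (inj₁ refl) = ⊥-elim (<-asym lt lt')

  -- Two placements with the same image subgraph coincide: for t ≥ 2 the vertices x and y are
  -- recovered as the vertices of degree ≥ 3, and the legs are then fixed once each f j is
  -- confined to a class of its own; for t = 1 an ordering condition breaks the symmetry of C₄.
  module SameImage {n} (G : SimpleGraph n) (side : Fin n → Bool) (t : ℕ)
      (x y : Fin n) (f g : Fin t → Fin n) (x' y' : Fin n) (f' g' : Fin t → Fin n)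
      (P : Placement G side t x y f g) (P' : Placement G side t x' y' f' g')
      (sameAdj : ∀ i j → ImageOf.imageAdj G t x y f g i j ≡ ImageOf.imageAdj G t x' y' f' g' i j) where
    module D = PlacementCopy G side t x y f g P
    module D' = PlacementCopy G side t x' y' f' g' P'

    nbrs-y' : ∀ j v → hadj (true , just j) v ≡ true → D.φ v ≡ y ⊎ D.φ v ≡ f j
    nbrs-y' j (true , nothing) h = inj₁ refl
    nbrs-y' j (false , just k) h rewrite ==⇒≡ j k h = inj₂ refl
    nbrs-y' j (false , nothing) ()
    nbrs-y' j (true , just k) ()

    nbrs-x' : ∀ j v → hadj (false , just j) v ≡ true → D.φ v ≡ x ⊎ D.φ v ≡ g j
    nbrs-x' j (false , nothing) h = inj₁ refl
    nbrs-x' j (true , just k) h rewrite ==⇒≡ j k h = inj₂ refl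
    nbrs-x' j (true , nothing) ()
    nbrs-x' j (false , just k) ()

    nbrs-x : ∀ v → hadj (false , nothing) v ≡ true → (D.φ v ≡ y) ⊎ Σ (Fin t) (λ k → D.φ v ≡ f k)
    nbrs-x (true , nothing) h = inj₁ refl
    nbrs-x (false , just k) h = inj₂ (k , refl)
    nbrs-x (false , nothing) ()
    nbrs-x (true , just k) ()

    A-side : ∀ u → sideH u ≡ true → (D.φ u ≡ x) ⊎ Σ (Fin t) (λ j → D.φ u ≡ g j)
    A-side (false , nothing) _ = inj₁ refl
    A-side (true , just j) _ = inj₂ (j , refl)
    A-side (true , nothing) ()
    A-side (false , just j) ()

    B-side : ∀ u → sideH u ≡ false → (D.φ u ≡ y) ⊎ Σ (Fin t) (λ j → D.φ u ≡ f j)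
    B-side (true , nothing) _ = inj₁ refl
    B-side (false , just j) _ = inj₂ (j , refl)
    B-side (false , nothing) ()
    B-side (true , just j) ()

    D'-edge : ∀ u v → hadj u v ≡ true → D.imageAdj (D'.φ u) (D'.φ v) ≡ true
    D'-edge u v h = trans (sameAdj _ _) (trans (D'.imageAdj-φ u v) h)

    D'-vertex : ∀ u v → hadj u v ≡ true → Σ (HV t) λ u₀ → (D.φ u₀ ≡ D'.φ u) × (sideH u₀ ≡ sideH u)
    D'-vertex u v h with D.imageAdj-preimage _ _ (D'-edge u v h)
    ... | u₀ , e₀ = u₀ , e₀ , trans (sym (D.side-φ u₀)) (trans (cong side e₀) (D'.side-φ u))

    D'-neighbour : ∀ u w v → D.φ u ≡ D'.φ w → hadj w v ≡ true → Σ (HV t) λ v₀ → (D.φ v₀ ≡ D'.φ v) × (hadj u v₀ ≡ true)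
    D'-neighbour u w v e h = D.imageAdj-neighbour u _ (subst (λ z → D.imageAdj z _ ≡ true) (sym e) (D'-edge w v h))

    module TwoLegs (t₀ : ℕ) (t≡ : t ≡ suc (suc t₀)) where
      i₀ i₁ : Fin t
      i₀ = subst Fin (sym t≡) fzero
      i₁ = subst Fin (sym t≡) (fsuc fzero)

      i₀≢i₁ : ¬ i₀ ≡ i₁
      i₀≢i₁ = distinct t≡
        where distinct : ∀ {m} (q : m ≡ suc (suc t₀)) → ¬ subst Fin (sym q) fzero ≡ subst Fin (sym q) (fsuc fzero)
              distinct refl ()

      x≡x' : x ≡ x'
      x≡x' with D'-vertex (false , nothing) (true , nothing) refl
      ... | u₀ , e₀ , s₀ with A-side u₀ s₀
      ... | inj₁ p = trans (sym p) e₀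
      ... | inj₂ (j , p) = ⊥-elim (no-three-in-two (Placement.y≢f P' i₀) (Placement.y≢f P' i₁)
                              (λ e → i₀≢i₁ (Placement.f-injective P' i₀ i₁ e))
                              (in-y,fj (true , nothing) refl) (in-y,fj (false , just i₀) refl) (in-y,fj (false , just i₁) refl))
        where
        in-y,fj : ∀ v → hadj (false , nothing) v ≡ true → D'.φ v ≡ y ⊎ D'.φ v ≡ f j
        in-y,fj v h with D'-neighbour (true , just j) (false , nothing) v (sym (trans (sym e₀) p)) h
        ... | v₀ , ev₀ , hv₀ with nbrs-y' j v₀ hv₀
        ... | inj₁ q = inj₁ (trans (sym ev₀) q)
        ... | inj₂ q = inj₂ (trans (sym ev₀) q)

      y≡y' : y ≡ y'
      y≡y' with D'-vertex (true , nothing) (false , nothing) refl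
      ... | u₀ , e₀ , s₀ with B-side u₀ s₀
      ... | inj₁ p = trans (sym p) e₀
      ... | inj₂ (j , p) = ⊥-elim (no-three-in-two (Placement.x≢g P' i₀) (Placement.x≢g P' i₁)
                              (λ e → i₀≢i₁ (Placement.g-injective P' i₀ i₁ e))
                              (in-x,gj (false , nothing) refl) (in-x,gj (true , just i₀) refl) (in-x,gj (true , just i₁) refl))
        where
        in-x,gj : ∀ v → hadj (true , nothing) v ≡ true → D'.φ v ≡ x ⊎ D'.φ v ≡ g j
        in-x,gj v h with D'-neighbour (false , just j) (true , nothing) v (sym (trans (sym e₀) p)) h
        ... | v₀ , ev₀ , hv₀ with nbrs-x' j v₀ hv₀
        ... | inj₁ q = inj₁ (trans (sym ev₀) q)
        ... | inj₂ q = inj₂ (trans (sym ev₀) q)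

    module Legs (x≡x' : x ≡ x') (y≡y' : y ≡ y')
        (Class : Fin t → Fin n → Set) (classes-disjoint : ∀ v j k → Class j v → Class k v → j ≡ k)
        (f∈Class : ∀ j → Class j (f j)) (f'∈Class : ∀ j → Class j (f' j)) where
      f≡f' : ∀ j → f j ≡ f' j
      f≡f' j with D'-neighbour (false , nothing) (false , nothing) (false , just j) x≡x' refl
      ... | v₀ , ev₀ , hv₀ with nbrs-x v₀ hv₀
      ... | inj₁ q = ⊥-elim (Placement.y≢f P' j (trans (sym y≡y') (trans (sym q) ev₀)))
      ... | inj₂ (k , q) = trans (cong f (classes-disjoint (f' j) j k (f'∈Class j)
                                   (subst (Class k) (trans (sym q) ev₀) (f∈Class k)))) (trans (sym q) ev₀)

      g≡g' : ∀ j → g j ≡ g' j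
      g≡g' j with D'-neighbour (false , just j) (false , just j) (true , just j) (f≡f' j) (==-refl j)
      ... | v₀ , ev₀ , hv₀ with nbrs-x' j v₀ hv₀
      ... | inj₁ q = ⊥-elim (Placement.x≢g P' j (trans (sym x≡x') (trans (sym q) ev₀)))
      ... | inj₂ q = trans (sym q) ev₀

    module OneLeg (t≡1 : t ≡ 1) where
      i₀ : Fin t
      i₀ = subst Fin (sym t≡1) fzero

      only : ∀ (j : Fin t) → j ≡ i₀
      only j = lemma t≡1 j
        where lemma : ∀ {m} (q : m ≡ 1) (j : Fin m) → j ≡ subst Fin (sym q) fzero
              lemma refl fzero = refl

      D'-in-x,g : ∀ u v → hadj u v ≡ true → sideH u ≡ true → D'.φ u ≡ x ⊎ D'.φ u ≡ g i₀
      D'-in-x,g u v h s with D'-vertex u v h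
      ... | u₀ , e₀ , s₀ with A-side u₀ (trans s₀ s)
      ... | inj₁ p = inj₁ (trans (sym e₀) p)
      ... | inj₂ (j , p) = inj₂ (trans (sym e₀) (trans p (cong g (only j))))

      D'-in-y,f : ∀ u v → hadj u v ≡ true → sideH u ≡ false → D'.φ u ≡ y ⊎ D'.φ u ≡ f i₀
      D'-in-y,f u v h s with D'-vertex u v h
      ... | u₀ , e₀ , s₀ with B-side u₀ (trans s₀ s)
      ... | inj₁ p = inj₁ (trans (sym e₀) p)
      ... | inj₂ (j , p) = inj₂ (trans (sym e₀) (trans p (cong f (only j))))

      module Ordered (x<g : toℕ x < toℕ (g i₀)) (y<f : toℕ y < toℕ (f i₀))
               (x'<g' : toℕ x' < toℕ (g' i₀)) (y'<f' : toℕ y' < toℕ (f' i₀)) where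
        x,g≡ : (x' ≡ x) × (g' i₀ ≡ g i₀)
        x,g≡ = ordered-pair-unique x<g x'<g' (Placement.x≢g P' i₀)
                 (D'-in-x,g (false , nothing) (true , nothing) refl refl) (D'-in-x,g (true , just i₀) (true , nothing) refl refl)

        y,f≡ : (y' ≡ y) × (f' i₀ ≡ f i₀)
        y,f≡ = ordered-pair-unique y<f y'<f' (Placement.y≢f P' i₀)
                 (D'-in-y,f (true , nothing) (false , nothing) refl refl) (D'-in-y,f (false , just i₀) (false , nothing) refl refl)

        f≡f' : ∀ j → f j ≡ f' j
        f≡f' j rewrite only j = sym (proj₂ y,f≡)

        g≡g' : ∀ j → g j ≡ g' j
        g≡g' j rewrite only j = sym (proj₂ x,g≡)

module DegreeMoments where

  open Sums
  open PowerMean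
  open import Data.Nat
  open import Data.Nat.Properties
  open import Data.Bool using (Bool; true; false; not)
  open import Data.Bool.Properties using (not-involutive)
  open import Data.Fin using (Fin)
  open import Data.List using (List; map; concatMap; allFin)
  open import Data.List.Properties using (length-tabulate)
  open import Data.Product using (_×_; _,_)
  open import Relation.Binary.PropositionalEquality
  open import Data.Nat.Tactic.RingSolver

  ProperColouring : ∀ {n} → SimpleGraph n → (Fin n → Bool) → Set
  ProperColouring {n} G side = ∀ (i j : Fin n) → adj G i j ≡ true → side i ≡ not (side j)

  module Bipartite {n} (G : SimpleGraph n) (side : Fin n → Bool) (bip : ProperColouring G side) where

    V = allFin n

    a : Fin n → Fin n → ℕ
    a i j = 𝟙 (adj G i j)

    α β : Fin n → ℕ
    α i = 𝟙 (side i)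
    β i = 𝟙 (not (side i))

    deg : Fin n → ℕ
    deg i = ∑ V (a i)

    codeg : Fin n → Fin n → ℕ
    codeg x w = ∑ V (λ v → a x v * a w v)

    walk₃ : Fin n → Fin n → ℕ
    walk₃ x y = ∑ V (λ v → ∑ V (λ w → a x v * (a v w * a w y)))

    ca cb E SA SB H : ℕ
    ca = ∑ V α
    cb = ∑ V β
    E = ∑ V (λ x → α x * deg x)
    SA = ∑ V (λ x → α x * (deg x * deg x))
    SB = ∑ V (λ y → β y * (deg y * deg y))
    H = ∑ V (λ x → α x * ∑ V (λ y → a x y * walk₃ x y))

    side-flip : ∀ {i j} → adj G i j ≡ true → side j ≡ not (side i)
    side-flip {i} {j} i~j = trans (sym (not-involutive (side j))) (cong not (sym (bip i j i~j)))

    a-sym : ∀ i j → a i j ≡ a j i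
    a-sym i j = cong 𝟙 (symm G i j)

    a≤1 : ∀ i j → a i j ≤ 1
    a≤1 i j = 𝟙≤1 (adj G i j)

    a*α≡a*β : ∀ i j → a i j * α i ≡ a i j * β j
    a*α≡a*β i j with adj G i j in e
    ... | true rewrite bip i j e = refl
    ... | false = refl

    a*β≡a*α : ∀ i j → a i j * β i ≡ a i j * α j
    a*β≡a*α i j with adj G i j in e
    ... | true rewrite bip i j e with side j
    ... | true = refl
    ... | false = refl
    a*β≡a*α i j | false = refl

    ββ : ∀ i → β i * β i ≡ β i
    ββ i = 𝟙-idem (not (side i))

    E-via-B : E ≡ ∑ V (λ y → β y * deg y)
    E-via-B = begin
        ∑ V (λ x → α x * ∑ V (a x))
      ≡⟨ ∑-cong V (λ x → sym (∑-*l V (α x) (a x))) ⟩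
        ∑ V (λ x → ∑ V (λ y → α x * a x y))
      ≡⟨ ∑-cong V (λ x → ∑-cong V (λ y → trans (*-comm (α x) (a x y)) (trans (a*α≡a*β x y) (*-comm (a x y) (β y))))) ⟩
        ∑ V (λ x → ∑ V (λ y → β y * a x y))
      ≡⟨ ∑-swap V V (λ x y → β y * a x y) ⟩
        ∑ V (λ y → ∑ V (λ x → β y * a x y))
      ≡⟨ ∑-cong V (λ y → trans (∑-*l V (β y) (λ x → a x y)) (cong (β y *_) (∑-cong V (λ x → a-sym x y)))) ⟩
        ∑ V (λ y → β y * deg y) ∎
      where open ≡-Reasoning

    SB-via-edges : ∑ V (λ x → α x * ∑ V (λ y → a x y * deg y)) ≡ SB
    SB-via-edges = begin
        ∑ V (λ x → α x * ∑ V (λ y → a x y * deg y))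
      ≡⟨ ∑-cong V (λ x → sym (∑-*l V (α x) _)) ⟩
        ∑ V (λ x → ∑ V (λ y → α x * (a x y * deg y)))
      ≡⟨ ∑-cong V (λ x → ∑-cong V (λ y → pt x y)) ⟩
        ∑ V (λ x → ∑ V (λ y → (β y * deg y) * a y x))
      ≡⟨ ∑-swap V V _ ⟩
        ∑ V (λ y → ∑ V (λ x → (β y * deg y) * a y x))
      ≡⟨ ∑-cong V (λ y → trans (∑-*l V (β y * deg y) (a y)) (*-assoc (β y) (deg y) (deg y))) ⟩
        SB ∎
      where
      open ≡-Reasoning
      pt : ∀ x y → α x * (a x y * deg y) ≡ (β y * deg y) * a y x
      pt x y = begin
          α x * (a x y * deg y)
        ≡⟨ e1 (α x) (a x y) (deg y) ⟩
          (a x y * α x) * deg y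
        ≡⟨ cong (_* deg y) (a*α≡a*β x y) ⟩
          (a x y * β y) * deg y
        ≡⟨ cong (λ z → (z * β y) * deg y) (a-sym x y) ⟩
          (a y x * β y) * deg y
        ≡⟨ e2 (a y x) (β y) (deg y) ⟩
          (β y * deg y) * a y x ∎
        where e1 : ∀ p q r → p * (q * r) ≡ (q * p) * r
              e1 = solve-∀
              e2 : ∀ p q r → (p * q) * r ≡ (q * r) * p
              e2 = solve-∀

    SA-via-edges : ∑ V (λ x → α x * ∑ V (λ y → a x y * deg x)) ≡ SA
    SA-via-edges = ∑-cong V (λ x → cong (α x *_) (∑-*r V (deg x) (a x)))

    SB-via-codegrees : ∑ V (λ x → α x * ∑ V (λ w → α w * codeg x w)) ≡ SB
    SB-via-codegrees = begin
        ∑ V (λ x → α x * ∑ V (λ w → α w * codeg x w))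
      ≡⟨ ∑-cong V (λ x → trans (sym (∑-*l V (α x) _)) (∑-cong V (λ w → trans (cong (α x *_) (sym (∑-*l V (α w) _))) (sym (∑-*l V (α x) _))))) ⟩
        ∑ V (λ x → ∑ V (λ w → ∑ V (λ v → α x * (α w * (a x v * a w v)))))
      ≡⟨ ∑-cong V (λ x → ∑-swap V V _) ⟩
        ∑ V (λ x → ∑ V (λ v → ∑ V (λ w → α x * (α w * (a x v * a w v)))))
      ≡⟨ ∑-swap V V _ ⟩
        ∑ V (λ v → ∑ V (λ x → ∑ V (λ w → α x * (α w * (a x v * a w v)))))
      ≡⟨ ∑-cong V (λ v → ∑-cong V (λ x → ∑-cong V (λ w → pt x w v))) ⟩
        ∑ V (λ v → ∑ V (λ x → ∑ V (λ w → β v * (a v x * a v w))))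
      ≡⟨ ∑-cong V (λ v → trans (∑-cong V (λ x → ∑-*l V (β v) _)) (trans (∑-*l V (β v) _)
            (cong (β v *_) (trans (∑-cong V (λ x → ∑-*l V (a v x) (a v))) (∑-*r V (deg v) (a v)))))) ⟩
        SB ∎
      where
      open ≡-Reasoning
      pt : ∀ x w v → α x * (α w * (a x v * a w v)) ≡ β v * (a v x * a v w)
      pt x w v = begin
          α x * (α w * (a x v * a w v))
        ≡⟨ e1 (α x) (α w) (a x v) (a w v) ⟩
          (a x v * α x) * (a w v * α w)
        ≡⟨ cong₂ _*_ (a*α≡a*β x v) (a*α≡a*β w v) ⟩
          (a x v * β v) * (a w v * β v)
        ≡⟨ e2 (a x v) (a w v) (β v) ⟩
          (β v * β v) * (a x v * a w v)
        ≡⟨ cong₂ _*_ (ββ v) (cong₂ _*_ (a-sym x v) (a-sym w v)) ⟩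
          β v * (a v x * a v w) ∎
        where e1 : ∀ p q r s → p * (q * (r * s)) ≡ (r * p) * (s * q)
              e1 = solve-∀
              e2 : ∀ r s b → (r * b) * (s * b) ≡ (b * b) * (r * s)
              e2 = solve-∀

    α-common-neighbour : ∀ x w v → α x * (α w * (a x v * a w v)) ≡ α x * (a x v * a w v)
    α-common-neighbour x w v = begin
        α x * (α w * (a x v * a w v))
      ≡⟨ e₁ (α x) (α w) (a x v) (a w v) ⟩
        (a x v * α x) * (a w v * α w)
      ≡⟨ cong₂ _*_ (a*α≡a*β x v) (a*α≡a*β w v) ⟩
        (a x v * β v) * (a w v * β v)
      ≡⟨ e₂ (a x v) (a w v) (β v) ⟩
        (a x v * (β v * β v)) * a w v
      ≡⟨ cong (λ z → (a x v * z) * a w v) (ββ v) ⟩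
        (a x v * β v) * a w v
      ≡⟨ cong (_* a w v) (sym (a*α≡a*β x v)) ⟩
        (a x v * α x) * a w v
      ≡⟨ e₃ (a x v) (α x) (a w v) ⟩
        α x * (a x v * a w v) ∎
      where
      open ≡-Reasoning
      e₁ : ∀ p q r s → p * (q * (r * s)) ≡ (r * p) * (s * q)
      e₁ = solve-∀
      e₂ : ∀ r s b → (r * b) * (s * b) ≡ (r * (b * b)) * s
      e₂ = solve-∀
      e₃ : ∀ r p s → (r * p) * s ≡ p * (r * s)
      e₃ = solve-∀

    H-via-codegrees : H ≡ ∑ V (λ x → α x * ∑ V (λ w → α w * (codeg x w * codeg x w)))
    H-via-codegrees = begin
        H
      ≡⟨ ∑-cong V (λ x → trans (sym (∑-*l V (α x) _)) (∑-cong V (λ y → trans (cong (α x *_) (sym (∑-*l V (a x y) _)))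
            (trans (sym (∑-*l V (α x) _)) (∑-cong V (λ v → trans (cong (α x *_) (sym (∑-*l V (a x y) _))) (sym (∑-*l V (α x) _)))))))) ⟩
        ∑ V (λ x → ∑ V (λ y → ∑ V (λ v → ∑ V (λ w → T x y v w))))
      ≡⟨ sym (∑-cong V (λ x → trans (∑-swap V V _) (trans (∑-cong V (λ v → ∑-swap V V _)) (∑-swap V V _)))) ⟩
        ∑ V (λ x → ∑ V (λ w → ∑ V (λ v → ∑ V (λ y → T x y v w))))
      ≡⟨ ∑-cong V (λ x → ∑-cong V (λ w → ∑-cong V (λ v → ∑-cong V (λ y → pt x y v w)))) ⟩
        ∑ V (λ x → ∑ V (λ w → ∑ V (λ v → ∑ V (λ y → α x * (α w * ((a x v * a w v) * (a x y * a w y)))))))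
      ≡⟨ ∑-cong V (λ x → trans (∑-cong V (λ w → trans (∑-cong V (λ v → ∑-*l V (α x) _)) (trans (∑-*l V (α x) _)
            (cong (α x *_) (trans (∑-cong V (λ v → ∑-*l V (α w) _)) (trans (∑-*l V (α w) _)
              (cong (α w *_) (trans (∑-cong V (λ v → ∑-*l V (a x v * a w v) _)) (∑-*r V _ _))))))))) (∑-*l V (α x) _)) ⟩
        ∑ V (λ x → α x * ∑ V (λ w → α w * (codeg x w * codeg x w))) ∎
      where
      open ≡-Reasoning
      T : Fin n → Fin n → Fin n → Fin n → ℕ
      T x y v w = α x * (a x y * (a x v * (a v w * a w y)))
      pt : ∀ x y v w → T x y v w ≡ α x * (α w * ((a x v * a w v) * (a x y * a w y)))
      pt x y v w = begin
          α x * (a x y * (a x v * (a v w * a w y)))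
        ≡⟨ cong (λ z → α x * (a x y * (a x v * (z * a w y)))) (a-sym v w) ⟩
          α x * (a x y * (a x v * (a w v * a w y)))
        ≡⟨ e2 (α x) (a x y) (a x v) (a w v) (a w y) ⟩
          (α x * (a x v * a w v)) * (a x y * a w y)
        ≡⟨ cong (_* (a x y * a w y)) (sym (α-common-neighbour x w v)) ⟩
          (α x * (α w * (a x v * a w v))) * (a x y * a w y)
        ≡⟨ e3 (α x) (α w) (a x v * a w v) (a x y * a w y) ⟩
          α x * (α w * ((a x v * a w v) * (a x y * a w y))) ∎
        where
        e2 : ∀ p q r s u → p * (q * (r * (s * u))) ≡ (p * (r * s)) * (q * u)
        e2 = solve-∀
        e3 : ∀ p q r s → (p * (q * r)) * s ≡ p * (q * (r * s))
        e3 = solve-∀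

    walk₃-sym : ∀ x y → walk₃ x y ≡ walk₃ y x
    walk₃-sym x y = trans (∑-swap V V _) (∑-cong V (λ w → ∑-cong V (λ v → pt v w)))
      where
      pt : ∀ v w → a x v * (a v w * a w y) ≡ a y w * (a w v * a v x)
      pt v w = trans (cong₂ _*_ (a-sym x v) (cong₂ _*_ (a-sym v w) (a-sym w y))) (e (a v x) (a w v) (a y w))
        where e : ∀ p q r → p * (q * r) ≡ r * (q * p)
              e = solve-∀

    H-via-B : H ≡ ∑ V (λ x → β x * ∑ V (λ y → a x y * walk₃ x y))
    H-via-B = sym (begin
        ∑ V (λ x → β x * ∑ V (λ y → a x y * walk₃ x y))
      ≡⟨ ∑-cong V (λ x → sym (∑-*l V (β x) _)) ⟩
        ∑ V (λ x → ∑ V (λ y → β x * (a x y * walk₃ x y)))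
      ≡⟨ ∑-cong V (λ x → ∑-cong V (λ y → pt x y)) ⟩
        ∑ V (λ x → ∑ V (λ y → α y * (a y x * walk₃ y x)))
      ≡⟨ ∑-swap V V _ ⟩
        ∑ V (λ y → ∑ V (λ x → α y * (a y x * walk₃ y x)))
      ≡⟨ ∑-cong V (λ y → ∑-*l V (α y) _) ⟩
        H ∎)
      where
      open ≡-Reasoning
      pt : ∀ x y → β x * (a x y * walk₃ x y) ≡ α y * (a y x * walk₃ y x)
      pt x y = begin
          β x * (a x y * walk₃ x y)
        ≡⟨ e1 (β x) (a x y) (walk₃ x y) ⟩
          (a x y * β x) * walk₃ x y
        ≡⟨ cong₂ _*_ (a*β≡a*α x y) (walk₃-sym x y) ⟩
          (a x y * α y) * walk₃ y x
        ≡⟨ cong (λ z → (z * α y) * walk₃ y x) (a-sym x y) ⟩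
          (a y x * α y) * walk₃ y x
        ≡⟨ e2 (a y x) (α y) (walk₃ y x) ⟩
          α y * (a y x * walk₃ y x) ∎
        where e1 : ∀ p q r → p * (q * r) ≡ (q * p) * r
              e1 = solve-∀
              e2 : ∀ p q r → (p * q) * r ≡ q * (p * r)
              e2 = solve-∀

    m^2≡m*m : ∀ m → m ^ 2 ≡ m * m
    m^2≡m*m m = cong (m *_) (*-identityʳ m)

    E²≤cb*SB : E * E ≤ cb * SB
    E²≤cb*SB = begin
        E * E
      ≡⟨ sym (m^2≡m*m E) ⟩
        E ^ 2
      ≡⟨ cong (_^ 2) E-via-B ⟩
        ∑ V (λ i → β i * deg i) ^ 2
      ≤⟨ power-mean V β deg 1 ⟩
        cb ^ 1 * ∑ V (λ i → β i * deg i ^ 2)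
      ≡⟨ cong₂ _*_ (*-identityʳ cb) (∑-cong V (λ i → cong (β i *_) (m^2≡m*m (deg i)))) ⟩
        cb * SB ∎
      where open ≤-Reasoning

    pairs : List (Fin n × Fin n)
    pairs = concatMap (λ x → map (λ w → (x , w)) V) V

    ∑-pairs : (h : Fin n × Fin n → ℕ) → ∑ pairs h ≡ ∑ V (λ x → ∑ V (λ w → h (x , w)))
    ∑-pairs h = trans (∑-concatMap V _ h) (∑-cong V (λ x → ∑-map V (λ w → (x , w)) h))

    SB²≤ca²*H : SB * SB ≤ (ca * ca) * H
    SB²≤ca²*H = begin
        SB * SB
      ≡⟨ sym (m^2≡m*m SB) ⟩
        SB ^ 2
      ≡⟨ cong (_^ 2) (sym ∑gq≡SB) ⟩
        ∑ pairs (λ p → g p * q p) ^ 2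
      ≤⟨ power-mean pairs g q 1 ⟩
        ∑ pairs g ^ 1 * ∑ pairs (λ p → g p * q p ^ 2)
      ≡⟨ cong₂ _*_ (trans (*-identityʳ _) ∑g≡ca²) ∑gq²≡H ⟩
        (ca * ca) * H ∎
      where
      open ≤-Reasoning
      g q : Fin n × Fin n → ℕ
      g (x , w) = α x * α w
      q (x , w) = codeg x w
      ∑gq≡SB : ∑ pairs (λ p → g p * q p) ≡ SB
      ∑gq≡SB = trans (∑-pairs _) (trans (∑-cong V (λ x → trans (∑-cong V (λ w → *-assoc (α x) (α w) (codeg x w))) (∑-*l V (α x) _))) SB-via-codegrees)
      ∑g≡ca² : ∑ pairs g ≡ ca * ca
      ∑g≡ca² = trans (∑-pairs _) (sym (∑*∑ V V α α))
      ∑gq²≡H : ∑ pairs (λ p → g p * q p ^ 2) ≡ H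
      ∑gq²≡H = trans (∑-pairs _) (trans (∑-cong V (λ x → trans (∑-cong V (λ w → trans (*-assoc (α x) (α w) _) (cong (λ z → α x * (α w * z)) (m^2≡m*m (codeg x w))))) (∑-*l V (α x) _))) (sym H-via-codegrees))

    ∑≤n : (f : Fin n → ℕ) → (∀ i → f i ≤ 1) → ∑ V f ≤ n
    ∑≤n f h = ≤-trans (∑-mono V h) (≤-reflexive (trans (∑-const V 1) (trans (*-identityʳ _) (length-tabulate (λ i → i)))))

    ca≤n : ca ≤ n
    ca≤n = ∑≤n α (λ i → 𝟙≤1 (side i))

    cb≤n : cb ≤ n
    cb≤n = ∑≤n β (λ i → 𝟙≤1 (not (side i)))

    deg≤n : ∀ x → deg x ≤ n
    deg≤n x = ∑≤n (a x) (a≤1 x)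

    E≤ca*n : E ≤ ca * n
    E≤ca*n = ≤-trans (∑-mono V (λ x → *-monoʳ-≤ (α x) (deg≤n x))) (≤-reflexive (∑-*r V n α))

    E≤SA : E ≤ SA
    E≤SA = ∑-mono V (λ x → *-monoʳ-≤ (α x) (m≤m*m (deg x)))
      where m≤m*m : ∀ m → m ≤ m * m
            m≤m*m zero = z≤n
            m≤m*m (suc m) = m≤m*n (suc m) (suc m)

    32t*SB≤H : ∀ t → 32 * t * n ^ 3 ≤ E * E → 0 < ca → 32 * t * SB ≤ H
    32t*SB≤H t hyp ca>0 = *-cancelˡ-≤ (ca * ca) {{nz}} (begin
        (ca * ca) * (32 * t * SB)
      ≤⟨ *-monoˡ-≤ (32 * t * SB) (*-mono-≤ ca≤n ca≤n) ⟩
        (n * n) * (32 * t * SB)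
      ≡⟨ e1 n t SB ⟩
        SB * (32 * t * (n * n))
      ≤⟨ *-monoʳ-≤ SB 32tn²≤SB ⟩
        SB * SB
      ≤⟨ SB²≤ca²*H ⟩
        (ca * ca) * H ∎)
      where
      open ≤-Reasoning
      e1 : ∀ n t SB → (n * n) * (32 * t * SB) ≡ SB * (32 * t * (n * n))
      e1 = solve-∀
      e2 : ∀ n t → n * (32 * t * (n * n)) ≡ 32 * t * (n * (n * (n * 1)))
      e2 = solve-∀
      nz : NonZero (ca * ca)
      nz = >-nonZero (*-mono-< ca>0 ca>0)
      n>0 : 0 < n
      n>0 = ≤-trans ca>0 ca≤n
      32tn²≤SB : 32 * t * (n * n) ≤ SB
      32tn²≤SB = *-cancelˡ-≤ n {{>-nonZero n>0}} (begin
          n * (32 * t * (n * n))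
        ≡⟨ e2 n t ⟩
          32 * t * n ^ 3
        ≤⟨ hyp ⟩
          E * E
        ≤⟨ E²≤cb*SB ⟩
          cb * SB
        ≤⟨ *-monoˡ-≤ SB cb≤n ⟩
          n * SB ∎)

    ∑ₑ : (Fin n → Fin n → ℕ) → ℕ
    ∑ₑ f = ∑ V (λ x → ∑ V (λ y → (α x * a x y) * f x y))

    ∑ₑ-mono : ∀ {f h} → (∀ x y → f x y ≤ h x y) → ∑ₑ f ≤ ∑ₑ h
    ∑ₑ-mono f≤h = ∑-mono V (λ x → ∑-mono V (λ y → *-monoʳ-≤ (α x * a x y) (f≤h x y)))

    ∑ₑ-+ : ∀ f h → ∑ₑ (λ x y → f x y + h x y) ≡ ∑ₑ f + ∑ₑ h
    ∑ₑ-+ f h = trans (∑-cong V (λ x → trans (∑-cong V (λ y → *-distribˡ-+ (α x * a x y) (f x y) (h x y))) (∑-+ V _ _))) (∑-+ V _ _)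

    ∑ₑ-*l : ∀ k f → ∑ₑ (λ x y → k * f x y) ≡ k * ∑ₑ f
    ∑ₑ-*l k f = trans (∑-cong V (λ x → trans (∑-cong V (λ y → e (α x * a x y) k (f x y))) (∑-*l V k _))) (∑-*l V k _)
      where e : ∀ g k f → g * (k * f) ≡ k * (g * f)
            e = solve-∀

    ∑ₑ-weights≡E : ∑ V (λ x → ∑ V (λ y → α x * a x y)) ≡ E
    ∑ₑ-weights≡E = ∑-cong V (λ x → ∑-*l V (α x) (a x))

    ∑ₑdeg≡SA : ∑ₑ (λ x _ → deg x) ≡ SA
    ∑ₑdeg≡SA = trans (∑-cong V (λ x → trans (∑-cong V (λ y → *-assoc (α x) (a x y) _)) (∑-*l V (α x) _))) SA-via-edges

    ∑ₑdeg≡SB : ∑ₑ (λ _ y → deg y) ≡ SB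
    ∑ₑdeg≡SB = trans (∑-cong V (λ x → trans (∑-cong V (λ y → *-assoc (α x) (a x y) _)) (∑-*l V (α x) _))) SB-via-edges

    ∑ₑwalk₃≡H : ∑ₑ walk₃ ≡ H
    ∑ₑwalk₃≡H = ∑-cong V (λ x → trans (∑-cong V (λ y → *-assoc (α x) (a x y) _)) (∑-*l V (α x) _))

    ∑ₑ-const : ∀ k → ∑ₑ (λ _ _ → k) ≡ k * E
    ∑ₑ-const k = trans (∑-cong V (λ x → ∑-*r V k (λ y → α x * a x y))) (trans (∑-*r V k _) (trans (cong (_* k) ∑ₑ-weights≡E) (*-comm _ k)))

module UniqueLists where

  open import Data.Nat
  open import Data.Nat.Properties
  open import Data.List using (List; []; _∷_; map; concatMap; _++_; length; filter)
  open import Data.List.Relation.Unary.All as All using (All; []; _∷_)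
  open import Data.List.Relation.Unary.AllPairs using ([]; _∷_)
  import Data.List.Relation.Unary.AllPairs.Properties as APP
  open import Data.List.Relation.Unary.Any using (here; there; _─_; index)
  open import Data.List.Properties using (length-removeAt′)
  open import Data.List.Relation.Unary.Unique.Propositional using (Unique)
  import Data.List.Relation.Unary.Unique.Propositional.Properties as UP
  open import Data.List.Membership.Propositional using (_∈_; find)
  open import Data.List.Membership.Propositional.Properties using (∈-concatMap⁻; ∈-map⁻; ∈-filter⁻; ∈-++⁺ˡ; ∈-++⁺ʳ)
  open import Data.Product using (_×_; _,_; proj₂)
  open import Relation.Binary.PropositionalEquality
  open import Relation.Nullary using (¬_; yes; no; ¬?)
  open import Data.Empty using (⊥; ⊥-elim)
  open import Relation.Unary using (Decidable)

  module _ {A B : Set} where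
    Unique-concatMap⁺ : (tag : B → A) (F : A → List B) (xs : List A) → Unique xs → (∀ a → Unique (F a)) →
      (∀ a z → z ∈ F a → tag z ≡ a) → Unique (concatMap F xs)
    Unique-concatMap⁺ tag F [] u uF tg = []
    Unique-concatMap⁺ tag F (a ∷ xs) (a∉ ∷ u) uF tg = UP.++⁺ (uF a) (Unique-concatMap⁺ tag F xs u uF tg) disj
      where
      disj : ∀ {v} → ¬ (v ∈ F a × v ∈ concatMap F xs)
      disj {v} (m1 , m2) with find (∈-concatMap⁻ F {xs = xs} m2)
      ... | b , b∈ , m3 = All.lookup a∉ b∈ (trans (sym (tg a v m1)) (tg b v m3))

    Unique-map⁺-on : (f : A → B) (xs : List A) → Unique xs →
      (∀ a b → a ∈ xs → b ∈ xs → f a ≡ f b → a ≡ b) → Unique (map f xs)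
    Unique-map⁺-on f [] u inj = []
    Unique-map⁺-on f (a ∷ xs) (a∉ ∷ u) inj = hd ∷ Unique-map⁺-on f xs u (λ a b ma mb → inj a b (there ma) (there mb))
      where
      hd : All (λ z → ¬ f a ≡ z) (map f xs)
      hd = All.tabulate λ {z} z∈ e → let (b , b∈ , zb) = ∈-map⁻ f z∈ in
        All.lookup a∉ b∈ (inj a b (here refl) (there b∈) (trans e zb))

  module _ {A : Set} where
    ∈-─ : (xs : List A) {x z : A} (p : x ∈ xs) → z ∈ xs → ¬ z ≡ x → z ∈ (xs ─ p)
    ∈-─ (y ∷ xs) (here refl) (here refl) ne = ⊥-elim (ne refl)
    ∈-─ (y ∷ xs) (here _) (there q) ne = q
    ∈-─ (y ∷ xs) (there p) (here e) ne = here e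
    ∈-─ (y ∷ xs) (there p) (there q) ne = there (∈-─ xs p q ne)

    Unique-⊆⇒length≤ : (M prev : List A) → Unique M → (∀ {z} → z ∈ M → z ∈ prev) → length M ≤ length prev
    Unique-⊆⇒length≤ [] prev u sub = z≤n
    Unique-⊆⇒length≤ (z ∷ M) prev (z∉ ∷ u) sub =
      subst (suc (length M) ≤_) (sym (length-removeAt′ prev (index z∈)))
        (s≤s (Unique-⊆⇒length≤ M (prev ─ z∈) u
          (λ {w} w∈ → ∈-─ prev z∈ (sub (there w∈)) (λ e → All.lookup z∉ w∈ (sym e)))))
      where z∈ = sub (here refl)

    length≡filter+filter¬ : {P : A → Set} (P? : Decidable P) (L : List A) →
      length L ≡ length (filter P? L) + length (filter (λ x → ¬? (P? x)) L)
    length≡filter+filter¬ P? [] = refl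
    length≡filter+filter¬ P? (x ∷ L) with P? x
    ... | yes _ = cong suc (length≡filter+filter¬ P? L)
    ... | no _ = trans (cong suc (length≡filter+filter¬ P? L)) (sym (+-suc _ _))

    length≤avoiding+length : (L prev : List A) (P? : Decidable (λ w → w ∈ prev)) → Unique L →
      length L ≤ length (filter (λ w → ¬? (P? w)) L) + length prev
    length≤avoiding+length L prev P? u = begin
        length L
      ≡⟨ length≡filter+filter¬ P? L ⟩
        length (filter P? L) + length (filter (λ x → ¬? (P? x)) L)
      ≤⟨ +-monoˡ-≤ _ (Unique-⊆⇒length≤ (filter P? L) prev (APP.filter⁺ P? u) (λ m → proj₂ (∈-filter⁻ P? {xs = L} m))) ⟩
        length prev + length (filter (λ x → ¬? (P? x)) L)
      ≡⟨ +-comm (length prev) _ ⟩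
        length (filter (λ x → ¬? (P? x)) L) + length prev ∎
      where
      open ≤-Reasoning

  module _ {A : Set} where
    Unique-++⁻ˡ : (xs ys : List A) → Unique (xs ++ ys) → Unique xs
    Unique-++⁻ˡ [] ys u = []
    Unique-++⁻ˡ (x ∷ xs) ys (h ∷ u) = All.tabulate (λ m → All.lookup h (∈-++⁺ˡ m)) ∷ Unique-++⁻ˡ xs ys u

    Unique-++⁻ʳ : (xs ys : List A) → Unique (xs ++ ys) → Unique ys
    Unique-++⁻ʳ [] ys u = u
    Unique-++⁻ʳ (x ∷ xs) ys (h ∷ u) = Unique-++⁻ʳ xs ys u

    Unique-++⁻-disjoint : (xs ys : List A) → Unique (xs ++ ys) → ∀ {v} → v ∈ xs → v ∈ ys → ⊥
    Unique-++⁻-disjoint (x ∷ xs) ys (h ∷ u) (here refl) m2 = All.lookup h (∈-++⁺ʳ xs m2) refl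
    Unique-++⁻-disjoint (x ∷ xs) ys (h ∷ u) (there m1) m2 = Unique-++⁻-disjoint xs ys u m1 m2

module Chunks {A : Set} (wt : A → ℕ) where

  open Sums
  open UniqueLists
  open import Data.Nat
  open import Data.Nat.Properties
  open import Data.Fin using (Fin) renaming (zero to fzero; suc to fsuc)
  open import Data.Vec using (Vec; []; _∷_; lookup)
  open import Data.List using (List; []; _∷_; _++_)
  open import Data.List.Relation.Unary.Unique.Propositional using (Unique)
  open import Data.List.Membership.Propositional using (_∈_)
  open import Data.List.Membership.Propositional.Properties using (∈-++⁺ˡ; ∈-++⁺ʳ)
  open import Data.Product using (_×_; _,_; proj₁; proj₂)
  open import Relation.Binary.PropositionalEquality
  open import Relation.Nullary using (¬_; yes; no)
  open import Data.Empty using (⊥-elim)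

  split : ℕ → List A → List A × List A
  split θ [] = [] , []
  split θ (v ∷ L) with θ ≤? wt v
  ... | yes _ = (v ∷ []) , L
  ... | no _ = (v ∷ proj₁ (split (θ ∸ wt v) L)) , proj₂ (split (θ ∸ wt v) L)

  split-++ : ∀ θ L → proj₁ (split θ L) ++ proj₂ (split θ L) ≡ L
  split-++ θ [] = refl
  split-++ θ (v ∷ L) with θ ≤? wt v
  ... | yes _ = refl
  ... | no _ = cong (v ∷_) (split-++ (θ ∸ wt v) L)

  split-weight≥ : ∀ θ L → θ ≤ ∑ L wt → θ ≤ ∑ (proj₁ (split θ L)) wt
  split-weight≥ θ [] h = h
  split-weight≥ θ (v ∷ L) h with θ ≤? wt v
  ... | yes θ≤ = ≤-trans θ≤ (≤-reflexive (sym (+-identityʳ (wt v))))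
  ... | no θ≰ = begin
      θ                                          ≡⟨ sym (m+[n∸m]≡n (≰⇒≥ θ≰)) ⟩
      wt v + (θ ∸ wt v)                          ≤⟨ +-monoʳ-≤ (wt v) (split-weight≥ (θ ∸ wt v) L rest≥) ⟩
      wt v + ∑ (proj₁ (split (θ ∸ wt v) L)) wt   ∎
    where
    open ≤-Reasoning
    rest≥ : θ ∸ wt v ≤ ∑ L wt
    rest≥ = subst (θ ∸ wt v ≤_) (m+n∸m≡n (wt v) (∑ L wt)) (∸-monoˡ-≤ (wt v) h)

  split-weight≤ : ∀ M → (∀ v → wt v ≤ M) → ∀ θ L → ∑ (proj₁ (split θ L)) wt ≤ θ + M
  split-weight≤ M wt≤M θ [] = z≤n
  split-weight≤ M wt≤M θ (v ∷ L) with θ ≤? wt v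
  ... | yes _ = ≤-trans (≤-reflexive (+-identityʳ (wt v))) (≤-trans (wt≤M v) (m≤n+m M θ))
  ... | no θ≰ = begin
      wt v + ∑ (proj₁ (split (θ ∸ wt v) L)) wt   ≤⟨ +-monoʳ-≤ (wt v) (split-weight≤ M wt≤M (θ ∸ wt v) L) ⟩
      wt v + ((θ ∸ wt v) + M)                    ≡⟨ sym (+-assoc (wt v) (θ ∸ wt v) M) ⟩
      (wt v + (θ ∸ wt v)) + M                    ≡⟨ cong (_+ M) (m+[n∸m]≡n (≰⇒≥ θ≰)) ⟩
      θ + M                                      ∎
    where open ≤-Reasoning

  split-∑ : ∀ θ L → ∑ (proj₁ (split θ L)) wt + ∑ (proj₂ (split θ L)) wt ≡ ∑ L wt
  split-∑ θ L = trans (sym (∑-++ (proj₁ (split θ L)) _ wt)) (cong (λ z → ∑ z wt) (split-++ θ L))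

  chunks : (k : ℕ) → ℕ → List A → Vec (List A) k
  chunks zero θ L = []
  chunks (suc k) θ L = proj₁ (split θ L) ∷ chunks k θ (proj₂ (split θ L))

  -- Each greedy chunk overshoots θ by at most one element's weight M, whence the k·(θ + M).
  chunk-weight≥ : ∀ M → (∀ v → wt v ≤ M) → ∀ k θ L → k * (θ + M) ≤ ∑ L wt →
    ∀ j → θ ≤ ∑ (lookup (chunks k θ L) j) wt
  chunk-weight≥ M wt≤M (suc k) θ L h fzero =
    split-weight≥ θ L (≤-trans (m≤m+n θ M) (≤-trans (m≤m+n (θ + M) (k * (θ + M))) h))
  chunk-weight≥ M wt≤M (suc k) θ L h (fsuc j) = chunk-weight≥ M wt≤M k θ (proj₂ (split θ L)) rest≥ j
    where
    rest≥ : k * (θ + M) ≤ ∑ (proj₂ (split θ L)) wt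
    rest≥ = +-cancelˡ-≤ (θ + M) _ _ (begin
        (θ + M) + k * (θ + M)                                   ≤⟨ h ⟩
        ∑ L wt                                                  ≡⟨ sym (split-∑ θ L) ⟩
        ∑ (proj₁ (split θ L)) wt + ∑ (proj₂ (split θ L)) wt     ≤⟨ +-monoˡ-≤ _ (split-weight≤ M wt≤M θ L) ⟩
        (θ + M) + ∑ (proj₂ (split θ L)) wt                      ∎)
      where open ≤-Reasoning

  split-Unique : ∀ θ L → Unique L → Unique (proj₁ (split θ L)) × Unique (proj₂ (split θ L))
  split-Unique θ L u = Unique-++⁻ˡ _ _ u' , Unique-++⁻ʳ (proj₁ (split θ L)) _ u'
    where u' = subst Unique (sym (split-++ θ L)) u

  chunk-⊆ : ∀ k θ L j {v} → v ∈ lookup (chunks k θ L) j → v ∈ L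
  chunk-⊆ (suc k) θ L fzero m = subst (_ ∈_) (split-++ θ L) (∈-++⁺ˡ m)
  chunk-⊆ (suc k) θ L (fsuc j) m = subst (_ ∈_) (split-++ θ L) (∈-++⁺ʳ (proj₁ (split θ L)) (chunk-⊆ k θ _ j m))

  chunk-Unique : ∀ k θ L → Unique L → ∀ j → Unique (lookup (chunks k θ L) j)
  chunk-Unique (suc k) θ L u fzero = proj₁ (split-Unique θ L u)
  chunk-Unique (suc k) θ L u (fsuc j) = chunk-Unique k θ _ (proj₂ (split-Unique θ L u)) j

  chunks-disjoint : ∀ k θ L → Unique L → ∀ j j' {v} →
    v ∈ lookup (chunks k θ L) j → v ∈ lookup (chunks k θ L) j' → j ≡ j'
  chunks-disjoint (suc k) θ L u fzero fzero m₁ m₂ = refl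
  chunks-disjoint (suc k) θ L u fzero (fsuc j') m₁ m₂ =
    ⊥-elim (Unique-++⁻-disjoint _ _ (subst Unique (sym (split-++ θ L)) u) m₁ (chunk-⊆ k θ _ j' m₂))
  chunks-disjoint (suc k) θ L u (fsuc j) fzero m₁ m₂ =
    ⊥-elim (Unique-++⁻-disjoint _ _ (subst Unique (sym (split-++ θ L)) u) m₂ (chunk-⊆ k θ _ j m₁))
  chunks-disjoint (suc k) θ L u (fsuc j) (fsuc j') m₁ m₂ =
    cong fsuc (chunks-disjoint k θ _ (proj₂ (split-Unique θ L u)) j j' m₁ m₂)

-- Sequences (v_j , w_j), j < k, with v_j in the j-th class and the w_j distinct elements of Γ v_j
-- avoiding `used`; each w_j still has at least |Γ v_j| − bound choices.
module DistinctChoices {A : Set} (_≟ᴬ_ : DecidableEquality A) (Γ : A → List A)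
                       (Γ-Unique : ∀ v → Unique (Γ v)) (bound : ℕ) where

  open Sums
  open UniqueLists
  open import Data.Nat
  open import Data.Nat.Properties
  open import Data.Fin using (Fin) renaming (zero to fzero; suc to fsuc)
  open import Data.Vec using (Vec; []; _∷_; lookup)
  open import Data.List using (List; []; _∷_; map; concatMap; length; filter)
  open import Data.List.Properties using (length-map)
  open import Data.List.Relation.Unary.All using ([])
  open import Data.List.Relation.Unary.AllPairs using ([]; _∷_)
  open import Data.List.Relation.Unary.Any using (here; there)
  import Data.List.Relation.Unary.AllPairs.Properties as AllPairs
  import Data.List.Relation.Unary.Unique.Propositional.Properties as Unique
  open import Data.List.Membership.Propositional using (_∈_; _∉_; find)
  open import Data.List.Membership.Propositional.Properties using (∈-concatMap⁻; ∈-map⁻; ∈-filter⁻)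
  open import Data.List.Membership.DecPropositional _≟ᴬ_ using (_∈?_)
  open import Data.Product using (_×_; _,_; proj₁; proj₂)
  open import Relation.Binary.PropositionalEquality
  open import Relation.Nullary using (¬?)
  open import Data.Empty using (⊥-elim)

  weight : A → ℕ
  weight v = length (Γ v) ∸ bound

  fresh : A → List A → List A
  fresh v used = filter (λ w → ¬? (w ∈? used)) (Γ v)

  choices : (k : ℕ) → Vec (List A) k → List A → List (Vec (A × A) k)
  choices zero [] used = [] ∷ []
  choices (suc k) (C ∷ cls) used =
    concatMap (λ v → concatMap (λ w → map ((v , w) ∷_) (choices k cls (w ∷ used))) (fresh v used)) C

  weightProduct : ∀ {k} → Vec (List A) k → ℕ
  weightProduct [] = 1
  weightProduct (C ∷ cls) = ∑ C weight * weightProduct cls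

  weight≤#fresh : ∀ v used → length used ≤ bound → weight v ≤ length (fresh v used)
  weight≤#fresh v used used≤ = begin
      length (Γ v) ∸ bound                                 ≤⟨ ∸-monoʳ-≤ (length (Γ v)) used≤ ⟩
      length (Γ v) ∸ length used                           ≤⟨ ∸-monoˡ-≤ (length used)
                                                               (length≤avoiding+length (Γ v) used (_∈? used) (Γ-Unique v)) ⟩
      (length (fresh v used) + length used) ∸ length used  ≡⟨ m+n∸n≡m _ (length used) ⟩
      length (fresh v used)                                ∎
    where open ≤-Reasoning

  weightProduct≤#choices : ∀ k (cls : Vec (List A) k) used → length used + k ≤ bound →
    weightProduct cls ≤ length (choices k cls used)
  weightProduct≤#choices zero [] used h = ≤-refl
  weightProduct≤#choices (suc k) (C ∷ cls) used h = begin
      ∑ C weight * weightProduct cls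
    ≡⟨ sym (∑-*r C (weightProduct cls) weight) ⟩
      ∑ C (λ v → weight v * weightProduct cls)
    ≤⟨ ∑-mono C (λ v → *-monoˡ-≤ (weightProduct cls) (weight≤#fresh v used (≤-trans (m≤m+n _ (suc k)) h))) ⟩
      ∑ C (λ v → length (fresh v used) * weightProduct cls)
    ≡⟨ ∑-cong C (λ v → sym (∑-const (fresh v used) (weightProduct cls))) ⟩
      ∑ C (λ v → ∑ (fresh v used) (λ w → weightProduct cls))
    ≤⟨ ∑-mono C (λ v → ∑-mono (fresh v used) (λ w →
         ≤-trans (weightProduct≤#choices k cls (w ∷ used) (h′ {w})) (≤-reflexive (sym (length-map _ (choices k cls (w ∷ used))))))) ⟩
      ∑ C (λ v → ∑ (fresh v used) (λ w → length (map ((v , w) ∷_) (choices k cls (w ∷ used)))))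
    ≡⟨ ∑-cong C (λ v → sym (length-concatMap (fresh v used) _)) ⟩
      ∑ C (λ v → length (concatMap (λ w → map ((v , w) ∷_) (choices k cls (w ∷ used))) (fresh v used)))
    ≡⟨ sym (length-concatMap C _) ⟩
      length (choices (suc k) (C ∷ cls) used) ∎
    where
    open ≤-Reasoning
    h′ : ∀ {w} → length (w ∷ used) + k ≤ bound
    h′ = ≤-trans (≤-reflexive (sym (+-suc (length used) k))) h

  head : ∀ {k} → Vec (A × A) (suc k) → A × A
  head (p ∷ _) = p

  choices-Unique : ∀ k (cls : Vec (List A) k) used → (∀ j → Unique (lookup cls j)) → Unique (choices k cls used)
  choices-Unique zero [] used h = [] ∷ []
  choices-Unique (suc k) (C ∷ cls) used h =
    Unique-concatMap⁺ (λ s → proj₁ (head s)) _ C (h fzero)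
      (λ v → Unique-concatMap⁺ (λ s → proj₂ (head s)) _ (fresh v used) (AllPairs.filter⁺ _ (Γ-Unique v))
        (λ w → Unique.map⁺ ∷-injectiveʳ (choices-Unique k cls (w ∷ used) (λ j → h (fsuc j))))
        (head₂ v))
      head₁
    where
    ∷-injectiveʳ : ∀ {p} {a b : Vec (A × A) k} → (p ∷ a) ≡ (p ∷ b) → a ≡ b
    ∷-injectiveʳ refl = refl
    head₂ : ∀ v w z → z ∈ map ((v , w) ∷_) (choices k cls (w ∷ used)) → proj₂ (head z) ≡ w
    head₂ v w z m with ∈-map⁻ _ m
    ... | s , _ , refl = refl
    head₁ : ∀ v z → z ∈ concatMap (λ w → map ((v , w) ∷_) (choices k cls (w ∷ used))) (fresh v used) → proj₁ (head z) ≡ v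
    head₁ v z m with find (∈-concatMap⁻ _ {xs = fresh v used} m)
    ... | w , _ , m' with ∈-map⁻ _ m'
    ... | s , _ , refl = refl

  record Valid {k} (cls : Vec (List A) k) (used : List A) (s : Vec (A × A) k) : Set where
    field
      inClass : ∀ j → proj₁ (lookup s j) ∈ lookup cls j
      inΓ : ∀ j → proj₂ (lookup s j) ∈ Γ (proj₁ (lookup s j))
      unused : ∀ j → proj₂ (lookup s j) ∉ used
      injective : ∀ i j → proj₂ (lookup s i) ≡ proj₂ (lookup s j) → i ≡ j

  choice-Valid : ∀ k (cls : Vec (List A) k) used s → s ∈ choices k cls used → Valid cls used s
  choice-Valid zero [] used [] m = record { inClass = λ () ; inΓ = λ () ; unused = λ () ; injective = λ () }
  choice-Valid (suc k) (C ∷ cls) used z m with find (∈-concatMap⁻ _ {xs = C} m)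
  ... | v , v∈ , m₁ with find (∈-concatMap⁻ _ {xs = fresh v used} m₁)
  ... | w , w∈ , m₂ with ∈-map⁻ _ m₂
  ... | s , s∈ , refl = record { inClass = inClass′ ; inΓ = inΓ′ ; unused = unused′ ; injective = injective′ }
    where
    open Valid (choice-Valid k cls (w ∷ used) s s∈)
    w-fresh = ∈-filter⁻ (λ w → ¬? (w ∈? used)) {xs = Γ v} w∈
    inClass′ : ∀ j → proj₁ (lookup ((v , w) ∷ s) j) ∈ lookup (C ∷ cls) j
    inClass′ fzero = v∈
    inClass′ (fsuc j) = inClass j
    inΓ′ : ∀ j → proj₂ (lookup ((v , w) ∷ s) j) ∈ Γ (proj₁ (lookup ((v , w) ∷ s) j))
    inΓ′ fzero = proj₁ w-fresh
    inΓ′ (fsuc j) = inΓ j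
    unused′ : ∀ j → proj₂ (lookup ((v , w) ∷ s) j) ∉ used
    unused′ fzero = proj₂ w-fresh
    unused′ (fsuc j) m = unused j (there m)
    injective′ : ∀ i j → proj₂ (lookup ((v , w) ∷ s) i) ≡ proj₂ (lookup ((v , w) ∷ s) j) → i ≡ j
    injective′ fzero fzero e = refl
    injective′ fzero (fsuc j) e = ⊥-elim (unused j (here (sym e)))
    injective′ (fsuc i) fzero e = ⊥-elim (unused i (here e))
    injective′ (fsuc i) (fsuc j) e = cong fsuc (injective i j e)

module EdgeCopies where

  open Sums
  open Embedding using (_==_; fsuc-==; ==⇒≡; ==-false⇒≢)
  open UniqueLists
  open import Data.Nat
  open import Data.Nat.Properties
  open import Data.Nat.DivMod using (_/_; _%_; m≡m%n+[m/n]*n; m%n<n; m/n*n≤m)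
  open import Data.Bool using (Bool; true; false; not; _∧_)
  open import Data.Bool.Properties using (∧-identityʳ; T-∧; T-≡; T-not-≡)
  open import Function.Bundles using (Equivalence)
  open import Data.List.Membership.Propositional using (_∈_)
  open import Data.List.Membership.Propositional.Properties using (∈-filter⁻)
  open import Data.Product using (_×_; _,_; proj₂)
  open import Data.Fin using (Fin) renaming (zero to fzero; suc to fsuc; _≟_ to _≟ᶠ_)
  open import Data.Vec using (Vec; []; _∷_; lookup)
  open import Data.List using (List; []; length; filter; allFin)
  import Data.List.Relation.Unary.AllPairs.Properties as AllPairs
  import Data.List.Relation.Unary.Unique.Propositional.Properties as Unique
  open import Relation.Binary.PropositionalEquality
  open import Relation.Nullary using (¬_; yes; no)
  open import Relation.Nullary.Decidable using (T?)
  open import Data.Nat.Tactic.RingSolver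

  ∑-δ : ∀ {n} (y : Fin n) (h : Fin n → ℕ) → ∑ (allFin n) (λ v → 𝟙 (v == y) * h v) ≡ h y
  ∑-δ {suc n} fzero h = trans (∑ᶠ-suc n _) (trans (cong₂ _+_ (+-identityʳ (h fzero)) (∑-0 (allFin n))) (+-identityʳ (h fzero)))
  ∑-δ {suc n} (fsuc y) h = trans (∑ᶠ-suc n (λ v → 𝟙 (v == fsuc y) * h v))
    (trans (∑-cong (allFin n) (λ v → cong (λ b → 𝟙 b * h (fsuc v)) (fsuc-== v y))) (∑-δ y (λ v → h (fsuc v))))

  p*[q*r]≤q : ∀ {p q r} → p ≤ 1 → r ≤ 1 → p * (q * r) ≤ q
  p*[q*r]≤q {p} {q} {r} p≤1 r≤1 = begin
    p * (q * r)  ≤⟨ *-monoˡ-≤ (q * r) p≤1 ⟩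
    1 * (q * r)  ≡⟨ *-identityˡ (q * r) ⟩
    q * r        ≤⟨ *-monoʳ-≤ q r≤1 ⟩
    q * 1        ≡⟨ *-identityʳ q ⟩
    q            ∎
    where open ≤-Reasoning

  -- Shaped like the goals of walk-split after 𝟙 true * q has reduced to q + 0.
  q≤A+[q+0+B] : ∀ A B q → q ≤ A + ((q + 0) + B)
  q≤A+[q+0+B] A B q = ≤-trans (≤-reflexive (sym (+-identityʳ q))) (≤-trans (m≤m+n (q + 0) B) (m≤n+m _ A))

  q≤A+[0+q+0] : ∀ A q → q ≤ A + (0 + (q + 0))
  q≤A+[0+q+0] A q = ≤-trans (≤-reflexive (sym (+-identityʳ q))) (m≤n+m _ A)

  𝟙-∧-≤ : ∀ a b → 𝟙 (a ∧ b) ≤ 𝟙 a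
  𝟙-∧-≤ true b = 𝟙≤1 b
  𝟙-∧-≤ false b = z≤n

  module Walks {n} (G : SimpleGraph n) (x y : Fin n) where
    V = allFin n

    deg : Fin n → ℕ
    deg v = ∑ V (λ w → 𝟙 (adj G v w))

    Γ : Fin n → List (Fin n)
    Γ v = filter (λ w → T? (adj G y w ∧ (adj G v w ∧ not (w == x)))) V

    Γ-Unique : ∀ v → Unique (Γ v)
    Γ-Unique v = AllPairs.filter⁺ _ (Unique.allFin⁺ n)

    Xs : List (Fin n)
    Xs = filter (λ v → T? (adj G x v ∧ not (v == y))) V

    Xs-Unique : Unique Xs
    Xs-Unique = AllPairs.filter⁺ _ (Unique.allFin⁺ n)

    #Γ≤deg : ∀ v → length (Γ v) ≤ deg y
    #Γ≤deg v = ≤-trans (≤-reflexive (length-filter _ V)) (∑-mono V (λ w → 𝟙-∧-≤ (adj G y w) _))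

    #Xs≤deg : length Xs ≤ deg x
    #Xs≤deg = ≤-trans (≤-reflexive (length-filter _ V)) (∑-mono V (λ w → 𝟙-∧-≤ (adj G x w) _))

    ∈Xs⇒ : ∀ {v} → v ∈ Xs → adj G x v ≡ true × ¬ v ≡ y
    ∈Xs⇒ m with Equivalence.to T-∧ (proj₂ (∈-filter⁻ (λ v → T? (adj G x v ∧ not (v == y))) {xs = V} m))
    ... | x~v , v≠y = Equivalence.to T-≡ x~v , ==-false⇒≢ (Equivalence.to T-not-≡ v≠y)

    ∈Γ⇒ : ∀ {v w} → w ∈ Γ v → adj G y w ≡ true × adj G v w ≡ true × ¬ w ≡ x
    ∈Γ⇒ {v} m with Equivalence.to T-∧ (proj₂ (∈-filter⁻ (λ w → T? (adj G y w ∧ (adj G v w ∧ not (w == x)))) {xs = V} m))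
    ... | y~w , rest with Equivalence.to T-∧ rest
    ... | v~w , w≠x = Equivalence.to T-≡ y~w , Equivalence.to T-≡ v~w , ==-false⇒≢ (Equivalence.to T-not-≡ w≠x)

    ∑#Γ : ℕ
    ∑#Γ = ∑ Xs (λ v → length (Γ v))

    walks : ℕ
    walks = ∑ V (λ v → ∑ V (λ w → 𝟙 (adj G x v) * (𝟙 (adj G v w) * 𝟙 (adj G w y))))

    -- A walk x v w y has v ≠ y and w ≠ x (a leg), or v = y, or w = x.
    leg viaY viaX : Fin n → Fin n → ℕ
    leg v w = 𝟙 (adj G x v ∧ not (v == y)) * 𝟙 (adj G y w ∧ (adj G v w ∧ not (w == x)))
    viaY v w = 𝟙 (v == y) * 𝟙 (adj G y w)
    viaX v w = 𝟙 (w == x) * 𝟙 (adj G x v)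

    walk-split : ∀ v w → 𝟙 (adj G x v) * (𝟙 (adj G v w) * 𝟙 (adj G w y)) ≤ leg v w + (viaY v w + viaX v w)
    walk-split v w with v == y in v=y
    ... | true = ≤-trans (v≡y (==⇒≡ v y v=y))
                   (q≤A+[q+0+B] (𝟙 (adj G x v ∧ false) * 𝟙 (adj G y w ∧ (adj G v w ∧ not (w == x)))) (viaX v w) _)
      where
      v≡y : v ≡ y → 𝟙 (adj G x v) * (𝟙 (adj G v w) * 𝟙 (adj G w y)) ≤ 𝟙 (adj G y w)
      v≡y refl = p*[q*r]≤q (𝟙≤1 (adj G x v)) (𝟙≤1 (adj G w v))
    ... | false with w == x in w=x
    ...   | true = ≤-trans (w≡x (==⇒≡ w x w=x))
                     (q≤A+[0+q+0] (𝟙 (adj G x v ∧ true) * 𝟙 (adj G y w ∧ (adj G v w ∧ false))) _)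
      where
      w≡x : w ≡ x → 𝟙 (adj G x v) * (𝟙 (adj G v w) * 𝟙 (adj G w y)) ≤ 𝟙 (adj G x v)
      w≡x refl = ≤-trans (*-monoʳ-≤ (𝟙 (adj G x v)) (≤-trans (*-monoˡ-≤ _ (𝟙≤1 (adj G v x)))
                                                     (≤-trans (≤-reflexive (*-identityˡ _)) (𝟙≤1 (adj G x y)))))
                   (≤-reflexive (*-identityʳ _))
    ...   | false = ≤-trans (≤-reflexive walk≡leg) (m≤m+n _ _)
      where
      walk≡leg : 𝟙 (adj G x v) * (𝟙 (adj G v w) * 𝟙 (adj G w y)) ≡ 𝟙 (adj G x v ∧ true) * 𝟙 (adj G y w ∧ (adj G v w ∧ true))
      walk≡leg rewrite ∧-identityʳ (adj G x v) | ∧-identityʳ (adj G v w) | 𝟙-∧ (adj G y w) (adj G v w) | symm G w y =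
        cong (𝟙 (adj G x v) *_) (*-comm (𝟙 (adj G v w)) (𝟙 (adj G y w)))

    ∑#Γ≡∑leg : ∑#Γ ≡ ∑ V (λ v → ∑ V (λ w → leg v w))
    ∑#Γ≡∑leg = trans (∑-filter _ V _) (∑-cong V (λ v →
      trans (cong (𝟙 (adj G x v ∧ not (v == y)) *_) (length-filter _ V))
            (sym (∑-*l V (𝟙 (adj G x v ∧ not (v == y))) (λ w → 𝟙 (adj G y w ∧ (adj G v w ∧ not (w == x))))))))

    walks≤ : walks ≤ ∑#Γ + deg x + deg y
    walks≤ = begin
        walks
      ≤⟨ ∑-mono V (λ v → ∑-mono V (λ w → walk-split v w)) ⟩
        ∑ V (λ v → ∑ V (λ w → leg v w + (viaY v w + viaX v w)))
      ≡⟨ ∑-cong V (λ v → trans (∑-+ V _ _) (cong (∑ V (leg v) +_) (∑-+ V _ _))) ⟩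
        ∑ V (λ v → ∑ V (leg v) + (∑ V (viaY v) + ∑ V (viaX v)))
      ≡⟨ trans (∑-+ V _ _) (cong (∑ V (λ v → ∑ V (leg v)) +_) (∑-+ V _ _)) ⟩
        ∑ V (λ v → ∑ V (leg v)) + (∑ V (λ v → ∑ V (viaY v)) + ∑ V (λ v → ∑ V (viaX v)))
      ≡⟨ cong₂ _+_ (sym ∑#Γ≡∑leg) (cong₂ _+_ ∑viaY ∑viaX) ⟩
        ∑#Γ + (deg y + deg x)
      ≡⟨ e ∑#Γ (deg y) (deg x) ⟩
        ∑#Γ + deg x + deg y ∎
      where
      open ≤-Reasoning
      ∑viaY : ∑ V (λ v → ∑ V (viaY v)) ≡ deg y
      ∑viaY = trans (∑-cong V (λ v → ∑-*l V (𝟙 (v == y)) _)) (∑-δ y (λ _ → deg y))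
      ∑viaX : ∑ V (λ v → ∑ V (viaX v)) ≡ deg x
      ∑viaX = ∑-cong V (λ v → trans (∑-*r V _ (λ w → 𝟙 (w == x)))
                (trans (cong (_* 𝟙 (adj G x v)) (trans (∑-cong V (λ w → sym (*-identityʳ _))) (∑-δ x (λ _ → 1))))
                       (*-identityˡ _)))
      e : ∀ m a b → m + (a + b) ≡ m + b + a
      e = solve-∀

  -- The threshold θe is chosen so that the neighbours of x split into t chunks each of
  -- weight at least θe.
  module Edge {n} (G : SimpleGraph n) (t₀ : ℕ) (x y : Fin n) where
    open Walks G x y public

    t : ℕ
    t = suc t₀

    open DistinctChoices _≟ᶠ_ Γ Γ-Unique t public
    open Chunks weight public

    U : ℕ
    U = ∑ Xs weight

    θe : ℕ
    θe = U / t ∸ deg y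

    cls : Vec (List (Fin n)) t
    cls = chunks t θe Xs

    eTree : List (Vec (Fin n × Fin n) t)
    eTree = choices t cls []

    weight≤deg : ∀ v → weight v ≤ deg y
    weight≤deg v = ≤-trans (m∸n≤m (length (Γ v)) t) (#Γ≤deg v)

    θ^k≤weightProduct : ∀ θ k (cl : Vec (List (Fin n)) k) → (∀ j → θ ≤ ∑ (lookup cl j) weight) → θ ^ k ≤ weightProduct cl
    θ^k≤weightProduct θ zero [] h = ≤-refl
    θ^k≤weightProduct θ (suc k) (C ∷ cl) h = *-mono-≤ (h fzero) (θ^k≤weightProduct θ k cl (λ j → h (fsuc j)))

    θe^t≤#eTree : θe ^ t ≤ length eTree
    θe^t≤#eTree with deg y ≤? U / t
    ... | no d≰ = subst (λ z → z ^ t ≤ length eTree) (sym (m≤n⇒m∸n≡0 (<⇒≤ (≰⇒> d≰)))) z≤n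
    ... | yes d≤ = ≤-trans (θ^k≤weightProduct θe t cls (chunk-weight≥ (deg y) weight≤deg t θe Xs t[θe+deg]≤U))
                           (weightProduct≤#choices t cls [] ≤-refl)
      where
      t[θe+deg]≤U : t * (θe + deg y) ≤ U
      t[θe+deg]≤U = begin
          t * (θe + deg y)  ≡⟨ cong (t *_) (m∸n+n≡m d≤) ⟩
          t * (U / t)       ≡⟨ *-comm t (U / t) ⟩
          (U / t) * t       ≤⟨ m/n*n≤m U t ⟩
          U                 ∎
        where open ≤-Reasoning

    U≤ : U ≤ t * θe + t * deg y + t
    U≤ = begin
        U                          ≡⟨ m≡m%n+[m/n]*n U t ⟩
        U % t + (U / t) * t        ≤⟨ +-mono-≤ (<⇒≤ (m%n<n U t)) (*-monoˡ-≤ t (m≤m∸n+n (U / t) (deg y))) ⟩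
        t + (θe + deg y) * t       ≡⟨ e t θe (deg y) ⟩
        t * θe + t * deg y + t     ∎
      where
      open ≤-Reasoning
      e : ∀ t a b → t + (a + b) * t ≡ t * a + t * b + t
      e = solve-∀

    ∑#Γ≤ : ∑#Γ ≤ U + t * deg x
    ∑#Γ≤ = begin
        ∑ Xs (λ v → length (Γ v))   ≤⟨ ∑-∸ Xs (λ v → length (Γ v)) (λ _ → t) ⟩
        U + ∑ Xs (λ _ → t)          ≡⟨ cong (U +_) (trans (∑-const Xs t) (*-comm (length Xs) t)) ⟩
        U + t * length Xs           ≤⟨ +-monoʳ-≤ U (*-monoʳ-≤ t #Xs≤deg) ⟩
        U + t * deg x               ∎
      where open ≤-Reasoning

    walks≤θe : walks ≤ t * θe + suc t * deg y + suc t * deg x + t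
    walks≤θe = begin
        walks
      ≤⟨ walks≤ ⟩
        ∑#Γ + deg x + deg y
      ≤⟨ +-monoˡ-≤ (deg y) (+-monoˡ-≤ (deg x) (≤-trans ∑#Γ≤ (+-monoˡ-≤ (t * deg x) U≤))) ⟩
        (t * θe + t * deg y + t) + t * deg x + deg x + deg y
      ≡⟨ e (t * θe) (deg y) (deg x) t ⟩
        t * θe + suc t * deg y + suc t * deg x + t ∎
      where
      open ≤-Reasoning
      e : ∀ a dy dx t → (a + t * dy + t) + t * dx + dx + dy ≡ a + suc t * dy + suc t * dx + t
      e = solve-∀

module FourCycleSymmetry where

  open Sums
  open Embedding using (_==_; ==-sym; ==-false⇒≢)
  open DegreeMoments
  open import Data.Nat
  open import Data.Nat.Properties
  open import Data.Bool using (Bool; true; false; not; _∧_; T)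
  open import Data.Bool.Properties using (∧-zeroʳ)
  open import Data.Fin using (Fin; toℕ)
  open import Data.Fin.Properties using (toℕ-injective)
  open import Data.List using (allFin)
  open import Relation.Binary.PropositionalEquality
  open import Relation.Nullary using (¬_)
  open import Data.Empty using (⊥-elim)
  open import Data.Nat.Tactic.RingSolver

  lt : ∀ {n} → Fin n → Fin n → ℕ
  lt a b = 𝟙 (toℕ a <ᵇ toℕ b)

  <ᵇ≡true⇒< : ∀ m k → (m <ᵇ k) ≡ true → m < k
  <ᵇ≡true⇒< m k e = <ᵇ⇒< m k (subst T (sym e) _)
  <ᵇ≡false⇒≮ : ∀ m k → (m <ᵇ k) ≡ false → ¬ m < k
  <ᵇ≡false⇒≮ m k e p = subst T e (<⇒<ᵇ p)

  lt+lt≡1 : ∀ {n} (a b : Fin n) → ¬ a ≡ b → lt a b + lt b a ≡ 1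
  lt+lt≡1 a b ne with toℕ a <ᵇ toℕ b in e1 | toℕ b <ᵇ toℕ a in e2
  ... | true | true = ⊥-elim (<-asym (<ᵇ≡true⇒< (toℕ a) (toℕ b) e1) (<ᵇ≡true⇒< (toℕ b) (toℕ a) e2))
  ... | true | false = refl
  ... | false | true = refl
  ... | false | false = ⊥-elim (ne (toℕ-injective (≤-antisym (≮⇒≥ (<ᵇ≡false⇒≮ (toℕ b) (toℕ a) e2)) (≮⇒≥ (<ᵇ≡false⇒≮ (toℕ a) (toℕ b) e1)))))

  module _ {n : ℕ} where
    private
      V = allFin n

    ∑⁴ : (Fin n → Fin n → Fin n → Fin n → ℕ) → ℕ
    ∑⁴ F = ∑ V (λ x → ∑ V (λ y → ∑ V (λ v → ∑ V (λ w → F x y v w))))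

    ∑⁴-swap : ∀ F → ∑⁴ F ≡ ∑⁴ (λ x y v w → F x v y w)
    ∑⁴-swap F = ∑-cong V (λ x → ∑-swap V V _)

    ∑⁴-reverse : ∀ F → ∑⁴ F ≡ ∑⁴ (λ x y v w → F w v y x)
    ∑⁴-reverse F = begin
        ∑⁴ F
      ≡⟨ ∑-cong V (λ x → ∑-cong V (λ y → ∑-swap V V _)) ⟩
        ∑ V (λ x → ∑ V (λ y → ∑ V (λ w → ∑ V (λ v → F x y v w))))
      ≡⟨ ∑-cong V (λ x → ∑-swap V V _) ⟩
        ∑ V (λ x → ∑ V (λ w → ∑ V (λ y → ∑ V (λ v → F x y v w))))
      ≡⟨ ∑-swap V V _ ⟩
        ∑ V (λ w → ∑ V (λ x → ∑ V (λ y → ∑ V (λ v → F x y v w))))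
      ≡⟨ ∑-cong V (λ w → ∑-cong V (λ x → ∑-swap V V _)) ⟩
        ∑ V (λ w → ∑ V (λ x → ∑ V (λ v → ∑ V (λ y → F x y v w))))
      ≡⟨ ∑-cong V (λ w → ∑-swap V V _) ⟩
        ∑ V (λ w → ∑ V (λ v → ∑ V (λ x → ∑ V (λ y → F x y v w))))
      ≡⟨ ∑-cong V (λ w → ∑-cong V (λ v → ∑-swap V V _)) ⟩
        ∑⁴ (λ x y v w → F w v y x) ∎
      where open ≡-Reasoning

    ∑⁴-+ : ∀ F H → ∑⁴ (λ x y v w → F x y v w + H x y v w) ≡ ∑⁴ F + ∑⁴ H
    ∑⁴-+ F H = trans (∑-cong V (λ x → trans (∑-cong V (λ y → trans (∑-cong V (λ v → ∑-+ V _ _)) (∑-+ V _ _))) (∑-+ V _ _))) (∑-+ V _ _)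

    ∑⁴-cong : ∀ {F H} → (∀ x y v w → F x y v w ≡ H x y v w) → ∑⁴ F ≡ ∑⁴ H
    ∑⁴-cong e = ∑-cong V (λ x → ∑-cong V (λ y → ∑-cong V (λ v → ∑-cong V (λ w → e x y v w))))

  -- Q x y v w counts the 4-cycle x y w v (x ∈ A) together with a labelling of it; the three
  -- symmetries of that labelling are relabellings of the summation variables.
  module FourCycles {n} (G : SimpleGraph n) (side : Fin n → Bool) (bip : ProperColouring G side) where
    open Bipartite G side bip

    𝟙≢ : Fin n → Fin n → ℕ
    𝟙≢ a b = 𝟙 (not (a == b))

    leg : Fin n → Fin n → Fin n → Fin n → ℕ
    leg x y v w = 𝟙 (adj G x v ∧ not (v == y)) * 𝟙 (adj G y w ∧ (adj G v w ∧ not (w == x)))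

    Q : Fin n → Fin n → Fin n → Fin n → ℕ
    Q x y v w = (α x * a x y) * leg x y v w

    leg≡ : ∀ x y v w → leg x y v w ≡ a x v * 𝟙≢ v y * (a y w * (a v w * 𝟙≢ w x))
    leg≡ x y v w rewrite 𝟙-∧ (adj G x v) (not (v == y)) | 𝟙-∧ (adj G y w) (adj G v w ∧ not (w == x))
                        | 𝟙-∧ (adj G v w) (not (w == x)) = refl

    Q-swap : ∀ x y v w → Q x y v w ≡ Q x v y w
    Q-swap x y v w rewrite leg≡ x y v w | leg≡ x v y w | ==-sym y v = e (α x) (a x y) (a x v) (𝟙≢ v y) (a y w) (a v w) (𝟙≢ w x)
      where e : ∀ A p q r s u z → (A * p) * (q * r * (s * (u * z))) ≡ (A * q) * (p * r * (u * (s * z)))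
            e = solve-∀

    α-path : ∀ w y x → α w * (a w y * a y x) ≡ α x * (a w y * a y x)
    α-path w y x = begin
        α w * (a w y * a y x)
      ≡⟨ sym (*-assoc (α w) (a w y) (a y x)) ⟩
        (α w * a w y) * a y x
      ≡⟨ cong (_* a y x) (trans (*-comm (α w) (a w y)) (a*α≡a*β w y)) ⟩
        (a w y * β y) * a y x
      ≡⟨ *-assoc (a w y) (β y) (a y x) ⟩
        a w y * (β y * a y x)
      ≡⟨ cong (a w y *_) (trans (*-comm (β y) (a y x)) (a*β≡a*α y x)) ⟩
        a w y * (a y x * α x)
      ≡⟨ e (a w y) (a y x) (α x) ⟩
        α x * (a w y * a y x) ∎
      where open ≡-Reasoning
            e : ∀ p q r → p * (q * r) ≡ r * (p * q)
            e = solve-∀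

    Q-reverse : ∀ x y v w → Q x y v w ≡ Q w v y x
    Q-reverse x y v w rewrite leg≡ x y v w | leg≡ w v y x | ==-sym w x = sym (begin
        (α w * a w v) * (a w y * 𝟙≢ y v * (a v x * (a y x * 𝟙≢ x w)))
      ≡⟨ e1 (α w) (a w v) (a w y) (𝟙≢ y v) (a v x) (a y x) (𝟙≢ x w) ⟩
        (α w * (a w y * a y x)) * (a w v * 𝟙≢ y v * a v x * 𝟙≢ x w)
      ≡⟨ cong (_* (a w v * 𝟙≢ y v * a v x * 𝟙≢ x w)) (α-path w y x) ⟩
        (α x * (a w y * a y x)) * (a w v * 𝟙≢ y v * a v x * 𝟙≢ x w)
      ≡⟨ cong₂ (λ p q → (α x * (p * q)) * (a w v * 𝟙≢ y v * a v x * 𝟙≢ x w)) (a-sym w y) (a-sym y x) ⟩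
        (α x * (a y w * a x y)) * (a w v * 𝟙≢ y v * a v x * 𝟙≢ x w)
      ≡⟨ cong₂ (λ p q → (α x * (a y w * a x y)) * (p * 𝟙≢ y v * q * 𝟙≢ x w)) (a-sym w v) (a-sym v x) ⟩
        (α x * (a y w * a x y)) * (a v w * 𝟙≢ y v * a x v * 𝟙≢ x w)
      ≡⟨ cong (λ z → (α x * (a y w * a x y)) * (a v w * z * a x v * 𝟙≢ x w)) (cong (λ b → 𝟙 (not b)) (==-sym y v)) ⟩
        (α x * (a y w * a x y)) * (a v w * 𝟙≢ v y * a x v * 𝟙≢ x w)
      ≡⟨ e2 (α x) (a y w) (a x y) (a v w) (𝟙≢ v y) (a x v) (𝟙≢ x w) ⟩
        (α x * a x y) * (a x v * 𝟙≢ v y * (a y w * (a v w * 𝟙≢ x w))) ∎)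
      where
      open ≡-Reasoning
      e1 : ∀ A p q r s u z → (A * p) * (q * r * (s * (u * z))) ≡ (A * (q * u)) * (p * r * s * z)
      e1 = solve-∀
      e2 : ∀ A p q r s u z → (A * (p * q)) * (r * s * u * z) ≡ (A * q) * (u * s * (p * (r * z)))
      e2 = solve-∀

    Q-orient : ∀ x y v w → Q x y v w ≡ Q x y v w * ((lt y v + lt v y) * (lt x w + lt w x))
    Q-orient x y v w with v == y in v=y
    ... | true rewrite ∧-zeroʳ (adj G x v) | *-zeroʳ (α x * a x y) = refl
    ... | false with w == x in w=x
    ...   | true rewrite ∧-zeroʳ (adj G v w) | ∧-zeroʳ (adj G y w) | *-zeroʳ (𝟙 (adj G x v ∧ true)) | *-zeroʳ (α x * a x y) = refl
    ...   | false rewrite lt+lt≡1 y v (λ e → ==-false⇒≢ v=y (sym e)) | lt+lt≡1 x w (λ e → ==-false⇒≢ w=x (sym e)) = sym (*-identityʳ _)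

    Q↗↗ Q↗↙ Q↙↗ Q↙↙ : Fin n → Fin n → Fin n → Fin n → ℕ
    Q↗↗ x y v w = Q x y v w * (lt y v * lt x w)
    Q↗↙ x y v w = Q x y v w * (lt y v * lt w x)
    Q↙↗ x y v w = Q x y v w * (lt v y * lt x w)
    Q↙↙ x y v w = Q x y v w * (lt v y * lt w x)

    ∑⁴Q≡4*∑⁴Q↗↗ : ∑⁴ Q ≡ 4 * ∑⁴ Q↗↗
    ∑⁴Q≡4*∑⁴Q↗↗ = begin
        ∑⁴ Q
      ≡⟨ ∑⁴-cong (λ x y v w → trans (Q-orient x y v w) (e (Q x y v w) (lt y v) (lt v y) (lt x w) (lt w x))) ⟩
        ∑⁴ (λ x y v w → Q↗↗ x y v w + (Q↗↙ x y v w + (Q↙↗ x y v w + Q↙↙ x y v w)))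
      ≡⟨ trans (∑⁴-+ Q↗↗ _) (cong (∑⁴ Q↗↗ +_) (trans (∑⁴-+ Q↗↙ _) (cong (∑⁴ Q↗↙ +_) (∑⁴-+ Q↙↗ Q↙↙)))) ⟩
        ∑⁴ Q↗↗ + (∑⁴ Q↗↙ + (∑⁴ Q↙↗ + ∑⁴ Q↙↙))
      ≡⟨ cong (λ z → ∑⁴ Q↗↗ + (z + (∑⁴ Q↙↗ + ∑⁴ Q↙↙))) E2 ⟩
        ∑⁴ Q↗↗ + (∑⁴ Q↙↗ + (∑⁴ Q↙↗ + ∑⁴ Q↙↙))
      ≡⟨ cong₂ (λ p q → ∑⁴ Q↗↗ + (p + (p + q))) E3 E4 ⟩
        ∑⁴ Q↗↗ + (∑⁴ Q↗↗ + (∑⁴ Q↗↗ + ∑⁴ Q↗↗))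
      ≡⟨ e4 (∑⁴ Q↗↗) ⟩
        4 * ∑⁴ Q↗↗ ∎
      where
      open ≡-Reasoning
      e : ∀ Q p q r s → Q * ((p + q) * (r + s)) ≡ Q * (p * r) + (Q * (p * s) + (Q * (q * r) + Q * (q * s)))
      e = solve-∀
      e4 : ∀ m → m + (m + (m + m)) ≡ 4 * m
      e4 = solve-∀
      E3 : ∑⁴ Q↙↗ ≡ ∑⁴ Q↗↗
      E3 = trans (∑⁴-cong (λ x y v w → cong (_* (lt v y * lt x w)) (Q-swap x y v w))) (∑⁴-swap (λ x y v w → Q x v y w * (lt v y * lt x w)))
      E2 : ∑⁴ Q↗↙ ≡ ∑⁴ Q↙↗
      E2 = trans (∑⁴-cong (λ x y v w → cong (_* (lt y v * lt w x)) (Q-reverse x y v w))) (sym (∑⁴-reverse Q↙↗))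
      E4 : ∑⁴ Q↙↙ ≡ ∑⁴ Q↗↗
      E4 = trans (∑⁴-cong (λ x y v w → cong (_* (lt v y * lt w x)) (Q-reverse x y v w))) (sym (∑⁴-reverse Q↗↗))

module Arithmetic where

  open import Data.Nat
  open import Data.Nat.Properties
  open import Relation.Binary.PropositionalEquality
  open import Data.Nat.Tactic.RingSolver
  open FactorialBound using (t^t≤4^t*t!)

  H≤2tΘ : ∀ t₀ E H Θ SA SB → let t = suc t₀ in
    H ≤ t * Θ + suc t * SB + suc t * SA + t * E → E ≤ SA → 32 * t * SB ≤ H → 32 * t * SA ≤ H →
    H ≤ 2 * t * Θ
  H≤2tΘ t₀ E H Θ SA SB h1 h2 h3 h4 = *-cancelˡ-≤ (16 * t) (+-cancelʳ-≤ ((3 * t + 2) * H) (16 * t * H) (16 * t * (2 * t * Θ)) (begin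
      16 * t * H + (3 * t + 2) * H
    ≤⟨ ≤-reflexive (e0 t H) ⟩
      (19 * t + 2) * H
    ≤⟨ *-monoˡ-≤ H (lem t₀) ⟩
      32 * t * H
    ≤⟨ *-monoʳ-≤ (32 * t) h1 ⟩
      32 * t * (t * Θ + suc t * SB + suc t * SA + t * E)
    ≤⟨ *-monoʳ-≤ (32 * t) (+-monoʳ-≤ (t * Θ + suc t * SB + suc t * SA) (*-monoʳ-≤ t h2)) ⟩
      32 * t * (t * Θ + suc t * SB + suc t * SA + t * SA)
    ≡⟨ e1 t Θ SB SA ⟩
      32 * t * t * Θ + suc t * (32 * t * SB) + (suc t + t) * (32 * t * SA)
    ≤⟨ +-mono-≤ (+-monoʳ-≤ (32 * t * t * Θ) (*-monoʳ-≤ (suc t) h3)) (*-monoʳ-≤ (suc t + t) h4) ⟩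
      32 * t * t * Θ + suc t * H + (suc t + t) * H
    ≡⟨ e2 t Θ H ⟩
      16 * t * (2 * t * Θ) + (3 * t + 2) * H ∎))
    where
    open ≤-Reasoning
    t = suc t₀
    lem : ∀ t₀ → 19 * suc t₀ + 2 ≤ 32 * suc t₀
    lem t₀ = subst₂ _≤_ (e₁ t₀) (e₂ t₀) (+-monoʳ-≤ (19 * t₀ + 19) (≤-trans (s≤s (s≤s z≤n)) (m≤m+n 13 (13 * t₀))))
      where e₁ : ∀ t₀ → (19 * t₀ + 19) + 2 ≡ 19 * suc t₀ + 2
            e₁ = solve-∀
            e₂ : ∀ t₀ → (19 * t₀ + 19) + (13 + 13 * t₀) ≡ 32 * suc t₀
            e₂ = solve-∀
    e0 : ∀ t H → 16 * t * H + (3 * t + 2) * H ≡ (19 * t + 2) * H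
    e0 = solve-∀
    e1 : ∀ t Θ SB SA → 32 * t * (t * Θ + suc t * SB + suc t * SA + t * SA) ≡ 32 * t * t * Θ + suc t * (32 * t * SB) + (suc t + t) * (32 * t * SA)
    e1 = solve-∀
    e2 : ∀ t Θ H → 32 * t * t * Θ + suc t * H + (suc t + t) * H ≡ 16 * t * (2 * t * Θ) + (3 * t + 2) * H
    e2 = solve-∀

  ^-distribʳ-* : ∀ a b k → (a * b) ^ k ≡ a ^ k * b ^ k
  ^-distribʳ-* a b zero = refl
  ^-distribʳ-* a b (suc k) rewrite ^-distribʳ-* a b k = e a b (a ^ k) (b ^ k)
    where e : ∀ a b p q → a * b * (p * q) ≡ a * p * (b * q)
          e = solve-∀

  [m*m]^t≡m^[2t] : ∀ a t → (a * a) ^ t ≡ a ^ (2 * t)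
  [m*m]^t≡m^[2t] a t = trans (cong (_^ t) (cong (a *_) (sym (*-identityʳ a)))) (^-*-assoc a 2 t)

  constants-bound : ∀ t₀ ca cb → let t = suc t₀ in
    (cb * cb) ^ t * (ca * ca) ^ t * (2 * t) ^ t ≤ 2 ^ (5 * t + 2) * t ! * ca ^ (2 * t) * cb ^ (2 * t)
  constants-bound t₀ ca cb = begin
      (cb * cb) ^ t * (ca * ca) ^ t * (2 * t) ^ t
    ≡⟨ cong₂ (λ p q → p * q * (2 * t) ^ t) ([m*m]^t≡m^[2t] cb t) ([m*m]^t≡m^[2t] ca t) ⟩
      cb ^ (2 * t) * ca ^ (2 * t) * (2 * t) ^ t
    ≡⟨ cong (cb ^ (2 * t) * ca ^ (2 * t) *_) (^-distribʳ-* 2 t t) ⟩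
      cb ^ (2 * t) * ca ^ (2 * t) * (2 ^ t * t ^ t)
    ≤⟨ *-monoʳ-≤ (cb ^ (2 * t) * ca ^ (2 * t)) (*-monoʳ-≤ (2 ^ t) (t^t≤4^t*t! t)) ⟩
      cb ^ (2 * t) * ca ^ (2 * t) * (2 ^ t * (4 ^ t * t !))
    ≡⟨ cong (λ z → cb ^ (2 * t) * ca ^ (2 * t) * (2 ^ t * (z * t !))) ([m*m]^t≡m^[2t] 2 t) ⟩
      cb ^ (2 * t) * ca ^ (2 * t) * (2 ^ t * (2 ^ (2 * t) * t !))
    ≡⟨ cong (λ z → cb ^ (2 * t) * ca ^ (2 * t) * z) (trans (sym (*-assoc (2 ^ t) _ _)) (cong (_* t !) (sym (^-distribˡ-+-* 2 t (2 * t))))) ⟩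
      cb ^ (2 * t) * ca ^ (2 * t) * (2 ^ (t + 2 * t) * t !)
    ≤⟨ *-monoʳ-≤ (cb ^ (2 * t) * ca ^ (2 * t)) (*-monoˡ-≤ (t !) (^-monoʳ-≤ 2 (3t≤5t+2 t₀))) ⟩
      cb ^ (2 * t) * ca ^ (2 * t) * (2 ^ (5 * t + 2) * t !)
    ≡⟨ e (cb ^ (2 * t)) (ca ^ (2 * t)) (2 ^ (5 * t + 2)) (t !) ⟩
      2 ^ (5 * t + 2) * t ! * ca ^ (2 * t) * cb ^ (2 * t) ∎
    where
    open ≤-Reasoning
    t = suc t₀
    3t≤5t+2 : ∀ t₀ → suc t₀ + 2 * suc t₀ ≤ 5 * suc t₀ + 2
    3t≤5t+2 t₀ = subst₂ _≤_ (e₁ t₀) (e₂ t₀) (m≤m+n (3 * suc t₀) (2 * suc t₀ + 2))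
      where e₁ : ∀ t₀ → 3 * suc t₀ ≡ suc t₀ + 2 * suc t₀
            e₁ = solve-∀
            e₂ : ∀ t₀ → 3 * suc t₀ + (2 * suc t₀ + 2) ≡ 5 * suc t₀ + 2
            e₂ = solve-∀
    e : ∀ b a p f → b * a * (p * f) ≡ p * f * a * b
    e = solve-∀

  E^[3t+1]≤ : ∀ t₀ E H Θ C ca cb → let t = suc t₀ in 1 ≤ E →
    H ≤ 2 * t * Θ →
    (E * E) * (E * E) ≤ (cb * cb) * ((ca * ca) * H) →
    Θ ^ t ≤ E ^ t₀ * C →
    E ^ (3 * t + 1) ≤ (cb * cb) ^ t * (ca * ca) ^ t * (2 * t) ^ t * C
  E^[3t+1]≤ t₀ E H Θ C ca cb E≥1 H≤2tΘ E⁴≤ Θ^t≤ = *-cancelˡ-≤ (E ^ t₀) {{m^n≢0 E t₀ {{>-nonZero E≥1}}}} (begin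
      E ^ t₀ * E ^ (3 * t + 1)
    ≡⟨ sym (^-distribˡ-+-* E t₀ (3 * t + 1)) ⟩
      E ^ (t₀ + (3 * t + 1))
    ≡⟨ cong (E ^_) (e₁ t₀) ⟩
      E ^ (4 * t)
    ≡⟨ sym (^-*-assoc E 4 t) ⟩
      (E ^ 4) ^ t
    ≡⟨ cong (_^ t) (e₂ E) ⟩
      ((E * E) * (E * E)) ^ t
    ≤⟨ ^-monoˡ-≤ t E⁴≤ ⟩
      ((cb * cb) * ((ca * ca) * H)) ^ t
    ≡⟨ trans (^-distribʳ-* (cb * cb) _ t) (cong ((cb * cb) ^ t *_) (^-distribʳ-* (ca * ca) H t)) ⟩
      (cb * cb) ^ t * ((ca * ca) ^ t * H ^ t)
    ≤⟨ *-monoʳ-≤ ((cb * cb) ^ t) (*-monoʳ-≤ ((ca * ca) ^ t) (^-monoˡ-≤ t H≤2tΘ)) ⟩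
      (cb * cb) ^ t * ((ca * ca) ^ t * (2 * t * Θ) ^ t)
    ≡⟨ cong (λ z → (cb * cb) ^ t * ((ca * ca) ^ t * z)) (^-distribʳ-* (2 * t) Θ t) ⟩
      (cb * cb) ^ t * ((ca * ca) ^ t * ((2 * t) ^ t * Θ ^ t))
    ≤⟨ *-monoʳ-≤ ((cb * cb) ^ t) (*-monoʳ-≤ ((ca * ca) ^ t) (*-monoʳ-≤ ((2 * t) ^ t) Θ^t≤)) ⟩
      (cb * cb) ^ t * ((ca * ca) ^ t * ((2 * t) ^ t * (E ^ t₀ * C)))
    ≡⟨ e₃ ((cb * cb) ^ t) ((ca * ca) ^ t) ((2 * t) ^ t) (E ^ t₀) C ⟩
      E ^ t₀ * ((cb * cb) ^ t * (ca * ca) ^ t * (2 * t) ^ t * C) ∎)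
    where
    open ≤-Reasoning
    t = suc t₀
    e₁ : ∀ t₀ → t₀ + (3 * suc t₀ + 1) ≡ 4 * suc t₀
    e₁ = solve-∀
    e₂ : ∀ E → E * (E * (E * (E * 1))) ≡ (E * E) * (E * E)
    e₂ = solve-∀
    e₃ : ∀ p q r s C → p * (q * (r * (s * C))) ≡ s * (p * q * r * C)
    e₃ = solve-∀

  counting-bound : ∀ t₀ E H Θ C c ca cb → let t = suc t₀ in 1 ≤ E →
    H ≤ 2 * t * Θ →
    (E * E) * (E * E) ≤ (cb * cb) * ((ca * ca) * H) →
    Θ ^ t ≤ E ^ t₀ * C → C ≤ c →
    E ^ (3 * t + 1) ≤ c * (2 ^ (5 * t + 2) * t ! * ca ^ (2 * t) * cb ^ (2 * t))
  counting-bound t₀ E H Θ C c ca cb E≥1 H≤2tΘ E⁴≤ Θ^t≤ C≤c = begin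
      E ^ (3 * t + 1)                                        ≤⟨ E^[3t+1]≤ t₀ E H Θ C ca cb E≥1 H≤2tΘ E⁴≤ Θ^t≤ ⟩
      (cb * cb) ^ t * (ca * ca) ^ t * (2 * t) ^ t * C        ≤⟨ *-mono-≤ (constants-bound t₀ ca cb) C≤c ⟩
      (2 ^ (5 * t + 2) * t ! * ca ^ (2 * t) * cb ^ (2 * t)) * c  ≡⟨ *-comm _ c ⟩
      c * (2 ^ (5 * t + 2) * t ! * ca ^ (2 * t) * cb ^ (2 * t)) ∎
    where
    open ≤-Reasoning
    t = suc t₀

  counting-bound-C₄ : ∀ E H c ca cb SA SB → H ≤ 4 * c + SA + SB → 32 * SA ≤ H → 32 * SB ≤ H →
    (E * E) * (E * E) ≤ (cb * cb) * ((ca * ca) * H) →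
    E ^ (3 * 1 + 1) ≤ c * (2 ^ (5 * 1 + 2) * 1 ! * ca ^ (2 * 1) * cb ^ (2 * 1))
  counting-bound-C₄ E H c ca cb SA SB h1 h2 h3 h4 = begin
      E ^ 4
    ≡⟨ e4 E ⟩
      (E * E) * (E * E)
    ≤⟨ h4 ⟩
      (cb * cb) * ((ca * ca) * H)
    ≤⟨ *-monoʳ-≤ (cb * cb) (*-monoʳ-≤ (ca * ca) H≤) ⟩
      (cb * cb) * ((ca * ca) * (128 * c))
    ≡⟨ e5 cb ca c ⟩
      c * (2 ^ (5 * 1 + 2) * 1 ! * ca ^ (2 * 1) * cb ^ (2 * 1)) ∎
    where
    open ≤-Reasoning
    e4 : ∀ E → E * (E * (E * (E * 1))) ≡ (E * E) * (E * E)
    e4 = solve-∀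
    e5 : ∀ cb ca c → (cb * cb) * ((ca * ca) * (128 * c)) ≡ c * (128 * 1 * (ca * (ca * 1)) * (cb * (cb * 1)))
    e5 = solve-∀
    H≤ : H ≤ 128 * c
    H≤ = ≤-trans (m≤n*m H 30) (+-cancelʳ-≤ (2 * H) (30 * H) (128 * c) (begin
        30 * H + 2 * H
      ≡⟨ sym (*-distribʳ-+ H 30 2) ⟩
        32 * H
      ≤⟨ *-monoʳ-≤ 32 h1 ⟩
        32 * (4 * c + SA + SB)
      ≡⟨ q c SA SB ⟩
        128 * c + 32 * SA + 32 * SB
      ≤⟨ +-mono-≤ (+-monoʳ-≤ (128 * c) h2) h3 ⟩
        128 * c + H + H
      ≡⟨ q2 c H ⟩
        128 * c + 2 * H ∎))
      where q : ∀ c SA SB → 32 * (4 * c + SA + SB) ≡ 128 * c + 32 * SA + 32 * SB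
            q = solve-∀
            q2 : ∀ c H → 128 * c + H + H ≡ 128 * c + 2 * H
            q2 = solve-∀

module FromDefs where

  open Sums
  open Embedding using (false≢true)
  open DegreeMoments
  open FourCycleSymmetry using (lt; lt+lt≡1)
  open import Data.Nat
  open import Data.Nat.Properties
  open import Data.Nat.ListAction using (sum)
  open import Data.Bool using (Bool; true; false; not; if_then_else_)
  open import Data.Fin using (Fin; toℕ)
  open import Data.Fin.Subset using (Subset; ∁)
  open import Data.Fin.Subset.Properties using (_∈?_)
  open import Data.Vec using ([]; _∷_)
  open import Data.List using (List; []; _∷_; map; allFin)
  open import Data.Product using (_,_)
  open import Data.Sum using (inj₁; inj₂)
  open import Relation.Binary.PropositionalEquality
  open import Relation.Nullary using (¬_; yes; no; does)
  open import Data.Empty using (⊥-elim)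
  open import Data.Nat.Tactic.RingSolver

  sideOf : ∀ {n} → Subset n → Fin n → Bool
  sideOf A i = does (i ∈? A)

  bipartition⇒proper : ∀ {n} (G : SimpleGraph n) (A : Subset n) → IsBipartition G A → ProperColouring G (sideOf A)
  bipartition⇒proper G A bp i j e with bp i j e | i ∈? A | j ∈? A
  ... | inj₁ (p , q) | yes _ | yes r = ⊥-elim (q r)
  ... | inj₁ (p , q) | yes _ | no _ = refl
  ... | inj₁ (p , q) | no r | _ = ⊥-elim (r p)
  ... | inj₂ (p , q) | yes r | _ = ⊥-elim (p r)
  ... | inj₂ (p , q) | no _ | yes _ = refl
  ... | inj₂ (p , q) | no _ | no r = ⊥-elim (r q)

  ∣A∣≡∑α : ∀ {n} (A : Subset n) → ∣ A ∣ ≡ ∑ (allFin n) (λ i → 𝟙 (sideOf A i))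
  ∣A∣≡∑α {zero} [] = refl
  ∣A∣≡∑α {suc n} (true ∷ A) = trans (cong suc (∣A∣≡∑α A)) (sym (∑ᶠ-suc n (λ i → 𝟙 (sideOf (true ∷ A) i))))
  ∣A∣≡∑α {suc n} (false ∷ A) = trans (∣A∣≡∑α A) (sym (∑ᶠ-suc n (λ i → 𝟙 (sideOf (false ∷ A) i))))

  ∣∁A∣≡∑β : ∀ {n} (A : Subset n) → ∣ ∁ A ∣ ≡ ∑ (allFin n) (λ i → 𝟙 (not (sideOf A i)))
  ∣∁A∣≡∑β {zero} [] = refl
  ∣∁A∣≡∑β {suc n} (true ∷ A) = trans (∣∁A∣≡∑β A) (sym (∑ᶠ-suc n (λ i → 𝟙 (not (sideOf (true ∷ A) i)))))
  ∣∁A∣≡∑β {suc n} (false ∷ A) = trans (cong suc (∣∁A∣≡∑β A)) (sym (∑ᶠ-suc n (λ i → 𝟙 (not (sideOf (false ∷ A) i)))))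

  sum-map≡∑ : ∀ {X : Set} (L : List X) (f : X → ℕ) → sum (map f L) ≡ ∑ L f
  sum-map≡∑ [] f = refl
  sum-map≡∑ (x ∷ L) f = cong (f x +_) (sum-map≡∑ L f)

  if-1-0≡𝟙 : ∀ b → (if b then 1 else 0) ≡ 𝟙 b
  if-1-0≡𝟙 true = refl
  if-1-0≡𝟙 false = refl

  module EdgeCount {n} (G : SimpleGraph n) (side : Fin n → Bool)
            (bip : ProperColouring G side) where
    open Bipartite G side bip

    α+β≡1 : ∀ i → α i + β i ≡ 1
    α+β≡1 i with side i
    ... | true = refl
    ... | false = refl

    adj⇒≢ : ∀ i j → adj G i j ≡ true → ¬ i ≡ j
    adj⇒≢ i j e refl = false≢true (trans (sym (irrefl G i)) e)

    α*a-split : ∀ i j → α i * a i j ≡ α i * a i j * (lt i j + lt j i)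
    α*a-split i j with adj G i j in e
    ... | false = trans (*-zeroʳ (α i)) (sym (cong (_* (lt i j + lt j i)) (*-zeroʳ (α i))))
    ... | true rewrite lt+lt≡1 i j (adj⇒≢ i j e) = sym (*-identityʳ _)

    lt*a-split : ∀ i j → lt i j * a i j * α i + lt i j * a i j * α j ≡ lt i j * a i j
    lt*a-split i j = begin
        lt i j * a i j * α i + lt i j * a i j * α j
      ≡⟨ cong (λ z → lt i j * a i j * α i + z) (trans (*-assoc (lt i j) (a i j) (α j)) (cong (lt i j *_) (sym (a*β≡a*α i j)))) ⟩
        lt i j * a i j * α i + lt i j * (a i j * β i)
      ≡⟨ e (lt i j) (a i j) (α i) (β i) ⟩
        lt i j * a i j * (α i + β i)
      ≡⟨ cong (lt i j * a i j *_) (α+β≡1 i) ⟩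
        lt i j * a i j * 1
      ≡⟨ *-identityʳ _ ⟩
        lt i j * a i j ∎
      where open ≡-Reasoning
            e : ∀ l a p q → l * a * p + l * (a * q) ≡ l * a * (p + q)
            e = solve-∀

    ∑lt*a≡E : ∑ V (λ i → ∑ V (λ j → lt i j * a i j)) ≡ E
    ∑lt*a≡E = sym (begin
        ∑ V (λ x → α x * ∑ V (a x))
      ≡⟨ ∑-cong V (λ i → trans (sym (∑-*l V (α i) (a i))) (∑-cong V (λ j → α*a-split i j))) ⟩
        ∑ V (λ i → ∑ V (λ j → α i * a i j * (lt i j + lt j i)))
      ≡⟨ ∑-cong V (λ i → trans (∑-cong V (λ j → trans (e (α i) (a i j) (lt i j) (lt j i)) (cong (λ z → lt i j * a i j * α i + lt j i * z * α i) (a-sym i j)))) (∑-+ V _ _)) ⟩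
        ∑ V (λ i → ∑ V (λ j → lt i j * a i j * α i) + ∑ V (λ j → lt j i * a j i * α i))
      ≡⟨ ∑-+ V _ _ ⟩
        ∑ V (λ i → ∑ V (λ j → lt i j * a i j * α i)) + ∑ V (λ i → ∑ V (λ j → lt j i * a j i * α i))
      ≡⟨ cong (∑ V (λ i → ∑ V (λ j → lt i j * a i j * α i)) +_) (∑-swap V V (λ i j → lt j i * a j i * α i)) ⟩
        ∑ V (λ i → ∑ V (λ j → lt i j * a i j * α i)) + ∑ V (λ j → ∑ V (λ i → lt j i * a j i * α i))
      ≡⟨ sym (∑-+ V _ _) ⟩
        ∑ V (λ i → ∑ V (λ j → lt i j * a i j * α i) + ∑ V (λ j → lt i j * a i j * α j))
      ≡⟨ ∑-cong V (λ i → trans (sym (∑-+ V _ _)) (∑-cong V (λ j → lt*a-split i j))) ⟩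
        ∑ V (λ i → ∑ V (λ j → lt i j * a i j)) ∎)
      where open ≡-Reasoning
            e : ∀ p q l l' → p * q * (l + l') ≡ l * q * p + l' * q * p
            e = solve-∀

  numEdges≡∑lt*a : ∀ {n} (G : SimpleGraph n) → numEdges G ≡ ∑ (allFin n) (λ i → ∑ (allFin n) (λ j → lt i j * 𝟙 (adj G i j)))
  numEdges≡∑lt*a {n} G = trans (sum-map≡∑ (allFin n) _) (∑-cong (allFin n) (λ i → trans (sum-map≡∑ (allFin n) _)
     (∑-cong (allFin n) (λ j → trans (if-1-0≡𝟙 _) (𝟙-∧ (toℕ i <ᵇ toℕ j) (adj G i j))))))

  numEdges≡E : ∀ {n} (G : SimpleGraph n) (A : Subset n) (bp : IsBipartition G A) →
    numEdges G ≡ Bipartite.E G (sideOf A) (bipartition⇒proper G A bp)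
  numEdges≡E G A bp = trans (numEdges≡∑lt*a G) (EdgeCount.∑lt*a≡E G (sideOf A) (bipartition⇒proper G A bp))

module CopyLists where

  open Sums
  open Embedding
  open Placements
  open DegreeMoments
  open EdgeCopies
  open UniqueLists
  open import Data.Nat
  open import Data.Nat.Properties
  open import Data.Bool using (Bool; true; not; _∧_)
  open import Data.Bool.Properties using (T-∧; T-≡)
  open import Data.Fin using (Fin)
  open import Data.Vec using (Vec; lookup)
  open import Data.List using (List; map; concatMap; length; filter)
  open import Data.List.Properties using (length-map)
  open import Data.List.Relation.Unary.All as All using (All)
  import Data.List.Relation.Unary.All.Properties as All
  import Data.List.Relation.Unary.AllPairs.Properties as AllPairs
  import Data.List.Relation.Unary.Unique.Propositional.Properties as Unique
  open import Data.List.Membership.Propositional using (_∈_; find)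
  open import Data.List.Membership.Propositional.Properties using (∈-concatMap⁻; ∈-map⁻; ∈-filter⁻)
  open import Data.Product using (_,_; proj₁; proj₂)
  open import Function.Bundles using (Equivalence)
  open import Relation.Binary.PropositionalEquality
  open import Relation.Nullary.Decidable using (T?)

  module _ {n} (G : SimpleGraph n) (side : Fin n → Bool) (bip : ProperColouring G side) where
    open Bipartite G side bip

    Ys : Fin n → List (Fin n)
    Ys x = filter (λ y → T? (side x ∧ adj G x y)) V

    ∈Ys⇒ : ∀ {x y} → y ∈ Ys x → side x ≡ true × adj G x y ≡ true
    ∈Ys⇒ {x} m with Equivalence.to T-∧ (proj₂ (∈-filter⁻ (λ y → T? (side x ∧ adj G x y)) {xs = V} m))
    ... | x∈A , x~y = Equivalence.to T-≡ x∈A , Equivalence.to T-≡ x~y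

    placement : ∀ {t} x y (f g : Fin t → Fin n) → y ∈ Ys x →
      (∀ j → f j ∈ Walks.Xs G x y) → (∀ j → g j ∈ Walks.Γ G x y (f j)) →
      (∀ i j → f i ≡ f j → i ≡ j) → (∀ i j → g i ≡ g j → i ≡ j) → Placement G side t x y f g
    placement x y f g y∈ f∈ g∈ f-inj g-inj = record
      { x~y = x~y ; x~f = λ j → proj₁ (Walks.∈Xs⇒ G x y (f∈ j)) ; y~g = y~g ; f~g = λ j → proj₁ (proj₂ (g-props j))
      ; x∈A = x∈A ; y∈B = y∈B ; f∈B = λ j → trans (side-flip (proj₁ (Walks.∈Xs⇒ G x y (f∈ j)))) (cong not x∈A)
      ; g∈A = λ j → trans (side-flip (y~g j)) (cong not y∈B)
      ; x≢g = λ j e → proj₂ (proj₂ (g-props j)) (sym e) ; y≢f = λ j e → proj₂ (Walks.∈Xs⇒ G x y (f∈ j)) (sym e)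
      ; f-injective = f-inj ; g-injective = g-inj }
      where
      x∈A = proj₁ (∈Ys⇒ y∈)
      x~y = proj₂ (∈Ys⇒ y∈)
      y∈B = trans (side-flip x~y) (cong not x∈A)
      g-props = λ j → Walks.∈Γ⇒ G x y (g∈ j)
      y~g = λ j → proj₁ (g-props j)

    module Listing (t : ℕ) (legs : Fin n → Fin n → List (Vec (Fin n × Fin n) t)) where

      Datum : Set
      Datum = Fin n × Fin n × Vec (Fin n × Fin n) t

      data-list : List Datum
      data-list = concatMap (λ x → concatMap (λ y → map (λ s → (x , y , s)) (legs x y)) (Ys x)) V

      fs gs : Vec (Fin n × Fin n) t → Fin t → Fin n
      fs s j = proj₁ (lookup s j)
      gs s j = proj₂ (lookup s j)

      image : Datum → Subgraph G
      image (x , y , s) = ImageOf.image G t x y (fs s) (gs s)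

      Member : Datum → Set
      Member d = Σ (Fin n) λ x → Σ (Fin n) λ y → Σ (Vec (Fin n × Fin n) t) λ s →
        (d ≡ (x , y , s)) × (y ∈ Ys x) × (s ∈ legs x y)

      member : ∀ d → d ∈ data-list → Member d
      member d m with find (∈-concatMap⁻ _ {xs = V} m)
      ... | x , _ , m₁ with find (∈-concatMap⁻ _ {xs = Ys x} m₁)
      ... | y , y∈ , m₂ with ∈-map⁻ _ m₂
      ... | s , s∈ , e = x , y , s , e , y∈ , s∈

      length-data-list : length data-list ≡ ∑ₑ (λ x y → length (legs x y))
      length-data-list = begin
          length data-list
        ≡⟨ length-concatMap V _ ⟩
          ∑ V (λ x → length (concatMap (λ y → map (λ s → (x , y , s)) (legs x y)) (Ys x)))
        ≡⟨ ∑-cong V (λ x → trans (length-concatMap (Ys x) _) (trans (∑-cong (Ys x) (λ y → length-map _ (legs x y))) (∑-filter _ V _))) ⟩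
          ∑ V (λ x → ∑ V (λ y → 𝟙 (side x ∧ adj G x y) * length (legs x y)))
        ≡⟨ ∑-cong V (λ x → ∑-cong V (λ y → cong (_* length (legs x y)) (𝟙-∧ (side x) (adj G x y)))) ⟩
          ∑ₑ (λ x y → length (legs x y)) ∎
        where open ≡-Reasoning

      same-image⇒same-adj : ∀ {x y s x' y' s'} → image (x , y , s) ≡ image (x' , y' , s') →
        ∀ i j → ImageOf.imageAdj G t x y (fs s) (gs s) i j ≡ ImageOf.imageAdj G t x' y' (fs s') (gs s') i j
      same-image⇒same-adj {x} {y} {s} {x'} {y'} {s'} eq i j =
        trans (sym (ImageOf.SEdge-image G t x y (fs s) (gs s) i j))
              (trans (cong (λ K → SEdge K i j) eq) (ImageOf.SEdge-image G t x' y' (fs s') (gs s') i j))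

      module Copies (legs-Unique : ∀ x y → Unique (legs x y))
                    (placed : ∀ x y s → y ∈ Ys x → s ∈ legs x y → Placement G side t x y (fs s) (gs s))
                    (recovered : ∀ x y s x' y' s' → y ∈ Ys x → s ∈ legs x y → y' ∈ Ys x' → s' ∈ legs x' y' →
                       (∀ i j → ImageOf.imageAdj G t x y (fs s) (gs s) i j ≡ ImageOf.imageAdj G t x' y' (fs s') (gs s') i j) →
                       _≡_ {A = Datum} (x , y , s) (x' , y' , s')) where

        data-list-Unique : Unique data-list
        data-list-Unique =
          Unique-concatMap⁺ proj₁ _ V (Unique.allFin⁺ n)
            (λ x → Unique-concatMap⁺ (λ d → proj₁ (proj₂ d)) _ (Ys x) (AllPairs.filter⁺ _ (Unique.allFin⁺ n))
              (λ y → Unique.map⁺ (λ { refl → refl }) (legs-Unique x y)) (y-tag x))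
            x-tag
          where
          y-tag : ∀ x y z → z ∈ map (λ s → (x , y , s)) (legs x y) → proj₁ (proj₂ z) ≡ y
          y-tag x y z m with ∈-map⁻ _ m
          ... | s , _ , refl = refl
          x-tag : ∀ x z → z ∈ concatMap (λ y → map (λ s → (x , y , s)) (legs x y)) (Ys x) → proj₁ z ≡ x
          x-tag x z m with find (∈-concatMap⁻ _ {xs = Ys x} m)
          ... | y , _ , m' with ∈-map⁻ _ m'
          ... | s , _ , refl = refl

        image-isCopy : ∀ d → Member d → IsCopy G t (image d)
        image-isCopy .(x , y , s) (x , y , s , refl , y∈ , s∈) =
          PlacementCopy.image-isCopy G side t x y (fs s) (gs s) (placed x y s y∈ s∈)

        image-injective : ∀ d d′ → d ∈ data-list → d′ ∈ data-list → image d ≡ image d′ → d ≡ d′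
        image-injective d d′ m m′ eq with member d m | member d′ m′
        ... | x , y , s , refl , y∈ , s∈ | x' , y' , s' , refl , y∈' , s∈' =
          recovered x y s x' y' s' y∈ s∈ y∈' s∈' (same-image⇒same-adj {x} {y} {s} {x'} {y'} {s'} eq)

        copies : AtLeastCopies G t (length data-list)
        copies = map image data-list
               , Unique-map⁺-on image data-list data-list-Unique image-injective
               , All.map⁺ (All.tabulate (λ {d} m → image-isCopy d (member d m)))
               , ≤-reflexive (sym (length-map image data-list))

module LargeT where

  open Sums
  open PowerMean using (power-mean)
  open Embedding using (module ImageOf)
  open Placements
  open Recovery
  open DegreeMoments
  open EdgeCopies
  open CopyLists
  open import Data.Nat
  open import Data.Nat.Properties
  open import Data.Vec using (Vec; []; lookup)
  open import Data.Vec.Properties using (tabulate∘lookup; tabulate-cong)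
  open import Data.List using (List; []; length)
  open import Data.List.Membership.Propositional using (_∈_)
  open import Data.Product using (_,_; proj₁; proj₂)
  open import Relation.Binary.PropositionalEquality

  module Counting {n} (G : SimpleGraph n) (side : Fin n → Bool) (bip : ProperColouring G side) (t₀ : ℕ) where
    open Bipartite G side bip

    t : ℕ
    t = suc t₀

    module Ed (x y : Fin n) = Edge G t₀ x y
    open Listing G side bip t Ed.eTree public

    eTree-Unique : ∀ x y → Unique (Ed.eTree x y)
    eTree-Unique x y = Ed.choices-Unique x y t (Ed.cls x y) [] (Ed.chunk-Unique x y t _ (Ed.Xs x y) (Ed.Xs-Unique x y))

    class-disjoint : ∀ x y v j k → v ∈ lookup (Ed.cls x y) j → v ∈ lookup (Ed.cls x y) k → j ≡ k
    class-disjoint x y v j k = Ed.chunks-disjoint x y t _ (Ed.Xs x y) (Ed.Xs-Unique x y) j k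

    placed : ∀ x y s → y ∈ Ys G side bip x → s ∈ Ed.eTree x y → Placement G side t x y (fs s) (gs s)
    placed x y s y∈ s∈ = placement G side bip x y (fs s) (gs s) y∈
      (λ j → Ed.chunk-⊆ x y t _ (Ed.Xs x y) j (Ed.Valid.inClass valid j)) (Ed.Valid.inΓ valid)
      (λ i j e → class-disjoint x y (fs s i) i j (Ed.Valid.inClass valid i)
                   (subst (λ z → z ∈ lookup (Ed.cls x y) j) (sym e) (Ed.Valid.inClass valid j)))
      (Ed.Valid.injective valid)
      where valid = Ed.choice-Valid x y t (Ed.cls x y) [] s s∈

    module _ (t₁ : ℕ) (t₀≡ : t₀ ≡ suc t₁) where
      recovered : ∀ x y s x' y' s' → y ∈ Ys G side bip x → s ∈ Ed.eTree x y → y' ∈ Ys G side bip x' → s' ∈ Ed.eTree x' y' →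
        (∀ i j → ImageOf.imageAdj G t x y (fs s) (gs s) i j ≡ ImageOf.imageAdj G t x' y' (fs s') (gs s') i j) →
        _≡_ {A = Datum} (x , y , s) (x' , y' , s')
      recovered x y s x' y' s' y∈ s∈ y∈' s∈' same =
        cong₂ _,_ x≡x' (cong₂ _,_ y≡y' (trans (sym (tabulate∘lookup s))
          (trans (tabulate-cong (λ j → cong₂ _,_ (f≡f' j) (g≡g' j))) (tabulate∘lookup s'))))
        where
        open SameImage G side t x y (fs s) (gs s) x' y' (fs s') (gs s') (placed x y s y∈ s∈) (placed x' y' s' y∈' s∈') same
        open TwoLegs t₁ (cong suc t₀≡)
        f'∈class : ∀ j → fs s' j ∈ lookup (Ed.cls x y) j
        f'∈class j = subst₂ (λ a b → fs s' j ∈ lookup (Ed.cls a b) j) (sym x≡x') (sym y≡y')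
                       (Ed.Valid.inClass (Ed.choice-Valid x' y' t (Ed.cls x' y') [] s' s∈') j)
        open Legs x≡x' y≡y' (λ j v → v ∈ lookup (Ed.cls x y) j) (class-disjoint x y)
                  (Ed.Valid.inClass (Ed.choice-Valid x y t (Ed.cls x y) [] s s∈)) f'∈class

      open Listing.Copies G side bip t Ed.eTree eTree-Unique placed recovered public

    Θ C : ℕ
    Θ = ∑ₑ Ed.θe
    C = ∑ₑ (λ x y → Ed.θe x y ^ t)

    C≤#data-list : C ≤ length data-list
    C≤#data-list = ≤-trans (∑ₑ-mono Ed.θe^t≤#eTree) (≤-reflexive (sym length-data-list))

    Θ^t≤E^t₀*C : Θ ^ t ≤ E ^ t₀ * C
    Θ^t≤E^t₀*C = subst₂ _≤_ (cong (_^ t) (∑-pairs _)) (cong₂ (λ p q → p ^ t₀ * q) (trans (∑-pairs _) ∑ₑ-weights≡E) (∑-pairs _))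
      (power-mean pairs (λ p → α (proj₁ p) * a (proj₁ p) (proj₂ p)) (λ p → Ed.θe (proj₁ p) (proj₂ p)) t₀)

    H≤tΘ+deg² : H ≤ t * Θ + suc t * SB + suc t * SA + t * E
    H≤tΘ+deg² = begin
        H
      ≡⟨ sym ∑ₑwalk₃≡H ⟩
        ∑ₑ walk₃
      ≤⟨ ∑ₑ-mono Ed.walks≤θe ⟩
        ∑ₑ (λ x y → t * Ed.θe x y + suc t * deg y + suc t * deg x + t)
      ≡⟨ trans (∑ₑ-+ _ _) (cong₂ _+_ (trans (∑ₑ-+ _ _) (cong₂ _+_ (trans (∑ₑ-+ _ _)
           (cong₂ _+_ (∑ₑ-*l t Ed.θe) (∑ₑ-*l (suc t) (λ _ y → deg y)))) (∑ₑ-*l (suc t) (λ x _ → deg x)))) (∑ₑ-const t)) ⟩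
        t * Θ + suc t * ∑ₑ (λ _ y → deg y) + suc t * ∑ₑ (λ x _ → deg x) + t * E
      ≡⟨ cong₂ (λ p q → t * Θ + suc t * p + suc t * q + t * E) ∑ₑdeg≡SB ∑ₑdeg≡SA ⟩
        t * Θ + suc t * SB + suc t * SA + t * E ∎
      where open ≤-Reasoning

module SingleT where

  open Sums
  open Embedding using (_==_; module ImageOf)
  open Placements
  open Recovery
  open DegreeMoments
  open EdgeCopies
  open FourCycleSymmetry
  open CopyLists
  open UniqueLists
  open import Data.Nat
  open import Data.Nat.Properties
  open import Data.Bool using (not; _∧_)
  open import Data.Fin using (toℕ) renaming (zero to fzero)
  open import Data.Vec using (Vec; []; _∷_)
  open import Data.Vec.Properties using (tabulate∘lookup; tabulate-cong)
  open import Data.List using (List; []; _∷_; map; concatMap; length; filter)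
  open import Data.List.Properties using (length-map)
  import Data.List.Relation.Unary.AllPairs.Properties as AllPairs
  import Data.List.Relation.Unary.Unique.Propositional.Properties as Unique
  open import Data.List.Membership.Propositional using (_∈_; find)
  open import Data.List.Membership.Propositional.Properties using (∈-concatMap⁻; ∈-map⁻; ∈-filter⁻)
  open import Data.Product using (_,_; proj₁; proj₂)
  open import Relation.Binary.PropositionalEquality
  open import Relation.Nullary.Decidable using (T?)
  open import Data.Nat.Tactic.RingSolver

  -- For t = 1 the copies are 4-cycles x y w v; listing only those with y < v and x < w
  -- (as vertex indices) picks exactly one of the four labellings of each.
  module Counting {n} (G : SimpleGraph n) (side : Fin n → Bool) (bip : ProperColouring G side) where
    open Bipartite G side bip
    open FourCycles G side bip
    module W (x y : Fin n) = Walks G x y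

    Vl : Fin n → Fin n → List (Fin n)
    Vl x y = filter (λ v → T? (toℕ y <ᵇ toℕ v)) (W.Xs x y)

    Wl : Fin n → Fin n → Fin n → List (Fin n)
    Wl x y v = filter (λ w → T? (toℕ x <ᵇ toℕ w)) (W.Γ x y v)

    legs : Fin n → Fin n → List (Vec (Fin n × Fin n) 1)
    legs x y = concatMap (λ v → map (λ w → (v , w) ∷ []) (Wl x y v)) (Vl x y)

    open Listing G side bip 1 legs public

    ∈legs⇒ : ∀ {x y s} → s ∈ legs x y →
      Σ (Fin n) λ v → Σ (Fin n) λ w → (s ≡ (v , w) ∷ []) × (v ∈ Vl x y) × (w ∈ Wl x y v)
    ∈legs⇒ {x} {y} m with find (∈-concatMap⁻ _ {xs = Vl x y} m)
    ... | v , v∈ , m′ with ∈-map⁻ _ m′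
    ... | w , w∈ , refl = v , w , refl , v∈ , w∈

    y<v : ∀ {x y v} → v ∈ Vl x y → toℕ y < toℕ v
    y<v {x} {y} {v} m = <ᵇ⇒< (toℕ y) (toℕ v) (proj₂ (∈-filter⁻ (λ v → T? (toℕ y <ᵇ toℕ v)) {xs = W.Xs x y} m))

    x<w : ∀ {x y v w} → w ∈ Wl x y v → toℕ x < toℕ w
    x<w {x} {y} {v} {w} m = <ᵇ⇒< (toℕ x) (toℕ w) (proj₂ (∈-filter⁻ (λ w → T? (toℕ x <ᵇ toℕ w)) {xs = W.Γ x y v} m))

    legs-Unique : ∀ x y → Unique (legs x y)
    legs-Unique x y =
      Unique-concatMap⁺ (λ s → fs s fzero) _ (Vl x y) (AllPairs.filter⁺ _ (W.Xs-Unique x y))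
        (λ v → Unique.map⁺ (λ { refl → refl }) (AllPairs.filter⁺ _ (W.Γ-Unique x y v)))
        v-tag
      where
      v-tag : ∀ v z → z ∈ map (λ w → (v , w) ∷ []) (Wl x y v) → fs z fzero ≡ v
      v-tag v z m with ∈-map⁻ _ m
      ... | w , _ , refl = refl

    placed : ∀ x y s → y ∈ Ys G side bip x → s ∈ legs x y → Placement G side 1 x y (fs s) (gs s)
    placed x y s y∈ s∈ with ∈legs⇒ s∈
    ... | v , w , refl , v∈ , w∈ = placement G side bip x y (fs s) (gs s) y∈
      (λ { fzero → proj₁ (∈-filter⁻ (λ v → T? (toℕ y <ᵇ toℕ v)) {xs = W.Xs x y} v∈) })
      (λ { fzero → proj₁ (∈-filter⁻ (λ w → T? (toℕ x <ᵇ toℕ w)) {xs = W.Γ x y v} w∈) })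
      (λ { fzero fzero _ → refl }) (λ { fzero fzero _ → refl })

    recovered : ∀ x y s x' y' s' → y ∈ Ys G side bip x → s ∈ legs x y → y' ∈ Ys G side bip x' → s' ∈ legs x' y' →
      (∀ i j → ImageOf.imageAdj G 1 x y (fs s) (gs s) i j ≡ ImageOf.imageAdj G 1 x' y' (fs s') (gs s') i j) →
      _≡_ {A = Datum} (x , y , s) (x' , y' , s')
    recovered x y s x' y' s' y∈ s∈ y∈' s∈' same with ∈legs⇒ s∈ | ∈legs⇒ s∈'
    ... | v , w , refl , v∈ , w∈ | v' , w' , refl , v∈' , w∈' =
      cong₂ _,_ (sym (proj₁ x,g≡)) (cong₂ _,_ (sym (proj₁ y,f≡))
        (trans (sym (tabulate∘lookup s)) (trans (tabulate-cong (λ j → cong₂ _,_ (f≡f' j) (g≡g' j))) (tabulate∘lookup s'))))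
      where
      open SameImage G side 1 x y (fs s) (gs s) x' y' (fs s') (gs s') (placed x y s y∈ s∈) (placed x' y' s' y∈' s∈') same
      open OneLeg.Ordered refl (x<w w∈) (y<v v∈) (x<w w∈') (y<v v∈')

    open Listing.Copies G side bip 1 legs legs-Unique placed recovered public

    #legs : ∀ x y → length (legs x y) ≡ ∑ V (λ v → ∑ V (λ w → leg x y v w * (lt y v * lt x w)))
    #legs x y = begin
        length (legs x y)
      ≡⟨ length-concatMap (Vl x y) _ ⟩
        ∑ (Vl x y) (λ v → length (map (λ w → (v , w) ∷ []) (Wl x y v)))
      ≡⟨ ∑-cong (Vl x y) (λ v → trans (length-map _ (Wl x y v)) (trans (length-filter _ (W.Γ x y v)) (∑-filter _ V (lt x)))) ⟩
        ∑ (Vl x y) (λ v → ∑ V (λ w → Γ? v w * lt x w))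
      ≡⟨ trans (∑-filter _ (W.Xs x y) _) (∑-filter _ V _) ⟩
        ∑ V (λ v → X? v * (lt y v * ∑ V (λ w → Γ? v w * lt x w)))
      ≡⟨ ∑-cong V (λ v → trans (cong (λ z → X? v * z) (sym (∑-*l V (lt y v) _))) (sym (∑-*l V (X? v) _))) ⟩
        ∑ V (λ v → ∑ V (λ w → X? v * (lt y v * (Γ? v w * lt x w))))
      ≡⟨ ∑-cong V (λ v → ∑-cong V (λ w → e (X? v) (lt y v) (Γ? v w) (lt x w))) ⟩
        ∑ V (λ v → ∑ V (λ w → leg x y v w * (lt y v * lt x w))) ∎
      where
      open ≡-Reasoning
      X? = λ v → 𝟙 (adj G x v ∧ not (v == y))
      Γ? = λ v w → 𝟙 (adj G y w ∧ (adj G v w ∧ not (w == x)))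
      e : ∀ p l q l′ → p * (l * (q * l′)) ≡ (p * q) * (l * l′)
      e = solve-∀

    #data-list≡∑⁴Q↗↗ : length data-list ≡ ∑⁴ Q↗↗
    #data-list≡∑⁴Q↗↗ = trans length-data-list (∑-cong V (λ x → ∑-cong V (λ y →
      trans (cong ((α x * a x y) *_) (#legs x y))
            (trans (sym (∑-*l V (α x * a x y) _)) (∑-cong V (λ v → trans (sym (∑-*l V (α x * a x y) _))
              (∑-cong V (λ w → sym (*-assoc (α x * a x y) (leg x y v w) _)))))))))

    ∑ₑ∑#Γ≡∑⁴Q : ∑ₑ W.∑#Γ ≡ ∑⁴ Q
    ∑ₑ∑#Γ≡∑⁴Q = ∑-cong V (λ x → ∑-cong V (λ y →
      trans (cong ((α x * a x y) *_) (W.∑#Γ≡∑leg x y))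
            (trans (sym (∑-*l V (α x * a x y) _)) (∑-cong V (λ v → sym (∑-*l V (α x * a x y) (W.leg x y v)))))))

    H≤4#+SA+SB : H ≤ 4 * length data-list + SA + SB
    H≤4#+SA+SB = begin
        H
      ≡⟨ sym ∑ₑwalk₃≡H ⟩
        ∑ₑ walk₃
      ≤⟨ ∑ₑ-mono W.walks≤ ⟩
        ∑ₑ (λ x y → W.∑#Γ x y + deg x + deg y)
      ≡⟨ trans (∑ₑ-+ _ _) (cong (_+ ∑ₑ (λ _ y → deg y)) (∑ₑ-+ _ _)) ⟩
        ∑ₑ W.∑#Γ + ∑ₑ (λ x _ → deg x) + ∑ₑ (λ _ y → deg y)
      ≡⟨ cong₂ _+_ (cong₂ _+_ (trans ∑ₑ∑#Γ≡∑⁴Q (trans ∑⁴Q≡4*∑⁴Q↗↗ (cong (4 *_) (sym #data-list≡∑⁴Q↗↗)))) ∑ₑdeg≡SA) ∑ₑdeg≡SB ⟩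
        4 * length data-list + SA + SB ∎
      where open ≤-Reasoning

module CopyBound {n} (G : SimpleGraph n) (side : Fin n → Bool) (bip : DegreeMoments.ProperColouring G side) where

  open Sums
  open DegreeMoments
  open Bipartite G side bip
  open Arithmetic
  open import Data.Nat
  open import Data.Nat.Properties
  open import Data.Bool using (not)
  open import Data.Bool.Properties using (not-involutive)
  open import Algebra.Properties.CommutativeSemigroup *-commutativeSemigroup using () renaming (interchange to *-interchange)
  open import Data.List using ([]; length)
  open import Data.List.Relation.Unary.All using ([])
  open import Data.List.Relation.Unary.AllPairs using ([])
  open import Data.Product using (_,_)
  open import Relation.Binary.PropositionalEquality
  open import Relation.Nullary using (yes; no)

  K : ℕ → ℕ
  K t = 2 ^ (5 * t + 2) * t ! * ca ^ (2 * t) * cb ^ (2 * t)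

  module Swapped = Bipartite G (λ i → not (side i)) (λ i j e → cong not (bip i j e))

  E⁴≤ca²cb²H : (E * E) * (E * E) ≤ (cb * cb) * ((ca * ca) * H)
  E⁴≤ca²cb²H = ≤-trans (*-mono-≤ E²≤cb*SB E²≤cb*SB)
                 (≤-trans (≤-reflexive (*-interchange cb SB cb SB)) (*-monoʳ-≤ (cb * cb) SB²≤ca²*H))

  E≡Swapped : Swapped.E ≡ E
  E≡Swapped = sym E-via-B

  0<ca : 1 ≤ E → 0 < ca
  0<ca E≥1 = n≢0⇒n>0 (λ ca≡0 → n≮0 (≤-trans E≥1 (subst (λ c → E ≤ c * n) ca≡0 E≤ca*n)))

  0<cb : 1 ≤ E → 0 < cb
  0<cb E≥1 = n≢0⇒n>0 (λ cb≡0 → n≮0 (≤-trans E≥1 (subst (λ c → E ≤ c * n) cb≡0 (subst (_≤ cb * n) E≡Swapped Swapped.E≤ca*n))))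

  32t*SA≤H : ∀ t → 32 * t * n ^ 3 ≤ E * E → 0 < cb → 32 * t * SA ≤ H
  32t*SA≤H t dense 0<cb = subst₂ (λ p q → 32 * t * p ≤ q) SB≡SA (sym H-via-B)
    (Swapped.32t*SB≤H t (subst (λ e → 32 * t * n ^ 3 ≤ e * e) (sym E≡Swapped) dense) 0<cb)
    where SB≡SA = ∑-cong V (λ y → cong (λ b → 𝟙 b * (deg y * deg y)) (not-involutive (side y)))

  copies-bound-nonempty : ∀ t₀ → 1 ≤ E → 32 * suc t₀ * n ^ 3 ≤ E * E →
    Σ ℕ λ c → AtLeastCopies G (suc t₀) c × E ^ (3 * suc t₀ + 1) ≤ c * K (suc t₀)
  copies-bound-nonempty zero E≥1 dense =
    length data-list , copies ,
    counting-bound-C₄ E H (length data-list) ca cb SA SB H≤4#+SA+SB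
      (32t*SA≤H 1 dense (0<cb E≥1)) (32t*SB≤H 1 dense (0<ca E≥1)) E⁴≤ca²cb²H
    where open SingleT.Counting G side bip
  copies-bound-nonempty (suc t₁) E≥1 dense =
    length data-list , copies t₁ refl ,
    counting-bound (suc t₁) E H Θ C (length data-list) ca cb E≥1
      (H≤2tΘ (suc t₁) E H Θ SA SB H≤tΘ+deg² E≤SA (32t*SB≤H (suc (suc t₁)) dense (0<ca E≥1)) (32t*SA≤H (suc (suc t₁)) dense (0<cb E≥1)))
      E⁴≤ca²cb²H Θ^t≤E^t₀*C C≤#data-list
    where open LargeT.Counting G side bip (suc t₁)

  copies-bound : ∀ t → 1 ≤ t → 32 * t * n ^ 3 ≤ E * E →
    Σ ℕ λ c → AtLeastCopies G t c × E ^ (3 * t + 1) ≤ c * K t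
  copies-bound (suc t₀) _ dense with E ≟ 0
  ... | yes E≡0 = 0 , ([] , [] , [] , z≤n) , subst (λ e → e ^ (3 * suc t₀ + 1) ≤ 0) (sym E≡0) z≤n
  ... | no E≢0 = copies-bound-nonempty t₀ (n≢0⇒n>0 E≢0) dense

open DegreeMoments using (module Bipartite)
open FromDefs using (sideOf; bipartition⇒proper; numEdges≡E; ∣A∣≡∑α; ∣∁A∣≡∑β)
open import Data.Nat.Properties using (*-identityʳ)
open import Data.Product using (map₂)
open import Relation.Binary.PropositionalEquality using (_≡_; refl; sym; trans; cong; subst)

bound-cong : ∀ {t c E E′ a a′ b b′} → E ≡ E′ → a ≡ a′ → b ≡ b′ →
  E ^ (3 * t + 1) ≤ c * (2 ^ (5 * t + 2) * t ! * a ^ (2 * t) * b ^ (2 * t)) →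
  E′ ^ (3 * t + 1) ≤ c * (2 ^ (5 * t + 2) * t ! * a′ ^ (2 * t) * b′ ^ (2 * t))
bound-cong refl refl refl bound = bound

lemma5p5 : (t : ℕ) → 1 ≤ t → (n : ℕ) → (G : SimpleGraph n) → (A : Subset n) →
    IsBipartition G A →
    32 * t * n ^ 3 ≤ numEdges G ^ 2 →
    Σ ℕ λ c → AtLeastCopies G t c ×
      numEdges G ^ (3 * t + 1) ≤ c * (2 ^ (5 * t + 2) * t ! * ∣ A ∣ ^ (2 * t) * ∣ ∁ A ∣ ^ (2 * t))
lemma5p5 t t≥1 n G A bipartition dense =
  map₂ (λ {c} → map₂ (bound-cong {t} {c} (sym E≡) (sym (∣A∣≡∑α A)) (sym (∣∁A∣≡∑β A))))
       (CopyBound.copies-bound G (sideOf A) proper t t≥1 dense′)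
  where
  proper = bipartition⇒proper G A bipartition
  open Bipartite G (sideOf A) proper using (E)
  E≡ : numEdges G ≡ E
  E≡ = numEdges≡E G A bipartition
  dense′ : 32 * t * n ^ 3 ≤ E * E
  dense′ = subst (32 * t * n ^ 3 ≤_) (trans (cong (_^ 2) E≡) (cong (E *_) (*-identityʳ E))) dense
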